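{- Let $G,H\in\mathbb{F}_q[x]$ both be square-free. Then $\mu(H)\,\eta(G,H)=\mu(G)\,\eta(H,G)$.
   Context: Let $\mathbb{F}_q$ be a finite field with $q$ elements and fix a non-trivial homomorphism $\lambda:(\mathbb{F}_q,+)\to\mathbb{C}^*$. For nonzero $M\in\mathbb{F}_q[x]$ of degree $m\ge1$ and $A\in\mathbb{F}_q[x]$, let $t_M(A)$ be the coefficient of $x^{m-1}$ in the remainder of $A$ on division by $M$ (if $m=0$, $t_M(A)=0$), and $E(G,M)(A)=\lambda(t_M(GA))$. For nonzero $H$, $\eta(G,H)=\sum_{D}E(G,H)(D)$, $D$ over a complete residue system modulo $H$ with $\gcd(D,H)=1$. The Möbius function $\mu$: $\mu(A)=0$ if $A=0$ or $P^2\mid A$ for some irreducible $P$, otherwise $(-1)^t$ with $t$ the number of distinct monic irreducible factors of $A$. Square-free means nonzero and not divisible by the square of any irreducible. -}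

module Defs where

open import Level using (0ℓ)
open import Data.Nat as ℕ using (ℕ; zero; suc; _∸_; _<ᵇ_)
open import Data.Integer as ℤ using (ℤ; +_; -[1+_])
open import Data.Bool using (if_then_else_)
open import Data.List using (List; []; _∷_; length; map; replicate; _++_; foldr)
open import Data.List.Membership.Propositional using (_∈_)
open import Data.List.Relation.Unary.Unique.Propositional using (Unique)
open import Data.List.Relation.Unary.All using (All)
open import Data.List.Relation.Unary.Any using (Any)
open import Data.List.Relation.Unary.AllPairs using (AllPairs)
open import Data.Product using (Σ; ∃; _×_; _,_)
open import Data.Sum using (_⊎_)
open import Relation.Nullary using (¬_; yes; no)
open import Relation.Binary.PropositionalEquality using (_≡_; _≢_)
open import Relation.Binary.Definitions using (DecidableEquality)
open import Algebra.Core using (Op₁; Op₂)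
open import Algebra.Structures using (IsCommutativeRing)
open import Algebra.Bundles using (CommutativeRing)

-- A finite field F_q (q = number of elements of `elements`).

record FiniteField : Set₁ where
  infixl 6 _+_
  infixl 7 _*_
  field
    Carrier           : Set
    _+_ _*_           : Op₂ Carrier
    -_                : Op₁ Carrier
    0# 1#             : Carrier
    isCommutativeRing : IsCommutativeRing _≡_ _+_ _*_ -_ 0# 1#
    _≟_               : DecidableEquality Carrier
    0≢1               : 0# ≢ 1#
    _⁻¹               : Op₁ Carrier
    inverseʳ          : ∀ x → x ≢ 0# → x * (x ⁻¹) ≡ 1#
    elements          : List Carrier
    complete          : ∀ x → x ∈ elements
    unique            : Unique elements

-- Polynomials F_q[x], as coefficient lists (constant term first).
-- Equality of polynomials is coefficientwise (trailing zeros ignored).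

module Polynomials (𝔽 : FiniteField) where
  open FiniteField 𝔽

  Poly : Set
  Poly = List Carrier

  coeff : Poly → ℕ → Carrier
  coeff []      _       = 0#
  coeff (a ∷ A) zero    = a
  coeff (a ∷ A) (suc n) = coeff A n

  infix 4 _≈ₚ_
  _≈ₚ_ : Poly → Poly → Set
  A ≈ₚ B = ∀ n → coeff A n ≡ coeff B n

  0ₚ 1ₚ : Poly
  0ₚ = []
  1ₚ = 1# ∷ []

  infixl 6 _+ₚ_ _-ₚ_
  infixl 7 _*ₚ_
  _+ₚ_ : Poly → Poly → Poly
  []      +ₚ B       = B
  (a ∷ A) +ₚ []      = a ∷ A
  (a ∷ A) +ₚ (b ∷ B) = (a + b) ∷ (A +ₚ B)

  negₚ : Poly → Poly
  negₚ = map -_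

  _-ₚ_ : Poly → Poly → Poly
  A -ₚ B = A +ₚ negₚ B

  scale : Carrier → Poly → Poly
  scale c = map (c *_)

  _*ₚ_ : Poly → Poly → Poly
  []      *ₚ B = []
  (a ∷ A) *ₚ B = scale a B +ₚ (0# ∷ (A *ₚ B))

  shift : ℕ → Poly → Poly
  shift k A = replicate k 0# ++ A

  consN : Carrier → Poly → Poly
  consN a [] with a ≟ 0#
  ... | yes _ = []
  ... | no  _ = a ∷ []
  consN a (b ∷ B) = a ∷ b ∷ B

  strip : Poly → Poly
  strip []      = []
  strip (a ∷ A) = consN a (strip A)

  -- len A = deg A + 1 for A ≠ 0, and len 0 = 0
  len : Poly → ℕ
  len A = length (strip A)

  lastOr0 : Poly → Carrier
  lastOr0 []          = 0#
  lastOr0 (a ∷ [])    = a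
  lastOr0 (a ∷ b ∷ B) = lastOr0 (b ∷ B)

  -- leading coefficient (0 for the zero polynomial)
  lc : Poly → Carrier
  lc A = lastOr0 (strip A)

  -- remainder of A on division by M (M ≠ 0), by long division;
  -- `fuel` bounds the number of reduction steps.
  remAux : ℕ → Poly → Poly → Poly
  remAux zero     A M = strip A
  remAux (suc f) A M =
    if len A ℕ.<ᵇ len M then strip A
    else remAux f (strip A -ₚ shift (len A ∸ len M) (scale (lc A * (lc M) ⁻¹) M)) M

  rem : Poly → Poly → Poly
  rem A M = remAux (length A) A (strip M)

  -- t_M(A): coefficient of x^(deg M - 1) in (A mod M); 0 if deg M = 0
  t : Poly → Poly → Carrier
  t M A with len M
  ... | zero          = 0#
  ... | suc zero      = 0#
  ... | suc (suc d)   = coeff (rem A M) d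

  infix 4 _∣ₚ_
  _∣ₚ_ : Poly → Poly → Set
  B ∣ₚ A = ∃ λ Q → A ≈ₚ Q *ₚ B

  Unit : Poly → Set
  Unit U = ∃ λ V → U *ₚ V ≈ₚ 1ₚ

  Monic : Poly → Set
  Monic P = lc P ≡ 1#

  Irreducible : Poly → Set
  Irreducible P = ¬ (P ≈ₚ 0ₚ) × ¬ Unit P × (∀ A B → P ≈ₚ A *ₚ B → Unit A ⊎ Unit B)

  SquareFree : Poly → Set
  SquareFree A = ¬ (A ≈ₚ 0ₚ) × (∀ P → Irreducible P → ¬ (P *ₚ P ∣ₚ A))

  Coprime : Poly → Poly → Set
  Coprime D H = ∀ C → C ∣ₚ D → C ∣ₚ H → Unit C

  Congruent : Poly → Poly → Poly → Set
  Congruent H A B = H ∣ₚ (A -ₚ B)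

  ReducedResidueSystem : Poly → List Poly → Set
  ReducedResidueSystem H L =
    All (λ D → Coprime D H) L ×
    AllPairs (λ A B → ¬ Congruent H A B) L ×
    (∀ A → Coprime A H → Any (Congruent H A) L)

  -- Möbius function, as the (functional) relation  μ(A) = z
  MobiusValue : Poly → ℤ → Set
  MobiusValue A z =
    ((A ≈ₚ 0ₚ ⊎ ∃ λ P → Irreducible P × (P *ₚ P ∣ₚ A)) × z ≡ + 0)
    ⊎ (¬ (A ≈ₚ 0ₚ) × (∀ P → Irreducible P → ¬ (P *ₚ P ∣ₚ A)) ×
       ∃ λ (Ps : List Poly) →
         All (λ P → Monic P × Irreducible P × P ∣ₚ A) Ps ×
         AllPairs (λ P Q → ¬ (P ≈ₚ Q)) Ps ×
         (∀ P → Monic P → Irreducible P → P ∣ₚ A → Any (P ≈ₚ_) Ps) ×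
         z ≡ (ℤ.- (+ 1)) ℤ.^ length Ps)

-- The target ring (standing in for ℂ): an integral domain

module _ (R : CommutativeRing 0ℓ 0ℓ) where
  open CommutativeRing R

  IsIntegralDomain : Set
  IsIntegralDomain = ¬ (1# ≈ 0#) × (∀ x y → x * y ≈ 0# → x ≈ 0# ⊎ y ≈ 0#)

  natR : ℕ → Carrier
  natR zero    = 0#
  natR (suc n) = 1# + natR n

  intR : ℤ → Carrier
  intR (+ n)      = natR n
  intR -[1+ n ]   = - natR (suc n)

  sumR : List Carrier → Carrier
  sumR = foldr _+_ 0#

record AdditiveCharacter (𝔽 : FiniteField) (R : CommutativeRing 0ℓ 0ℓ) : Set where
  private module F = FiniteField 𝔽
  open CommutativeRing R
  field
    λ-fun       : F.Carrier → Carrier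
    λ-hom       : ∀ a b → λ-fun (a F.+ b) ≈ λ-fun a * λ-fun b
    λ-zero      : λ-fun F.0# ≈ 1#
    nontrivial  : ∃ λ a → ¬ (λ-fun a ≈ 1#)

module Sums (𝔽 : FiniteField) (R : CommutativeRing 0ℓ 0ℓ) (ψ : AdditiveCharacter 𝔽 R) where
  open Polynomials 𝔽
  open AdditiveCharacter ψ

  E : Poly → Poly → Poly → CommutativeRing.Carrier R
  E G M A = λ-fun (t M (G *ₚ A))

  η : Poly → Poly → List Poly → CommutativeRing.Carrier R
  η G H L = sumR R (map (E G H) L)

-- Write P₁, …, Pᵣ for the monic prime factors of the square-free H. The reduced residues modulo H
-- are sieved out of all residues by inclusion–exclusion over the divisors D of H, and the sum of
-- E(G,H) over the multiples of D is q^(deg H − deg D) if H ∣ GD and 0 otherwise: in the second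
-- case B ↦ t_H(G·D·B) is a nonzero linear form, and the character sum of a nonzero linear form
-- vanishes. The sieve then factors as μ(H)·η(G,H) = ∏ᵢ (1 − [Pᵢ ∣ G]·q^(deg Pᵢ)), and this equals
-- the product of 1 − q^(deg P) over the common prime factors P of G and H, which is symmetric.

module Submission where

open import Defs
open import Level using (0ℓ)
open import Data.Bool using (true; false; T)
open import Data.Empty using (⊥; ⊥-elim)
open import Data.Unit using (⊤; tt)
open import Data.Maybe using (Maybe; just; nothing)
open import Data.Nat as ℕ using (ℕ; zero; suc; _∸_; _<ᵇ_; z≤n; s≤s)
  renaming (_+_ to _+ℕ_; _*_ to _*ℕ_; _≤_ to _≤ℕ_; _<_ to _<ℕ_)
import Data.Nat.Properties as ℕP
open import Data.Nat.ListAction using (sum)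
open import Data.Integer as ℤ using (ℤ)
import Data.Integer
import Data.Integer.Properties as ℤP
open import Data.Sign as Sign using (Sign)
open import Data.List using (List; []; _∷_; length; map; foldr; concatMap)
import Data.List.Properties as List
open import Data.List.Membership.Propositional using (_∈_)
open import Data.List.Relation.Unary.All using (All; []; _∷_)
import Data.List.Relation.Unary.All as All
import Data.List.Relation.Unary.All.Properties as All
open import Data.List.Relation.Unary.Any using (Any; here; there)
import Data.List.Relation.Unary.Any as Any
import Data.List.Relation.Unary.Any.Properties as Any
open import Data.List.Relation.Unary.AllPairs using (AllPairs; []; _∷_)
import Data.List.Relation.Unary.AllPairs as AllPairs
import Data.List.Relation.Unary.AllPairs.Properties as AllPairs
open import Data.Product using (Σ; ∃; _×_; _,_; proj₁; proj₂; swap)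
open import Data.Sum using (_⊎_; inj₁; inj₂; [_,_]′)
open import Relation.Nullary using (¬_; yes; no; Dec)
open import Relation.Nullary.Decidable using (¬¬-excluded-middle)
import Relation.Binary.PropositionalEquality as ≡
open ≡ using (_≡_; _≢_)
open import Relation.Binary.Structures using (IsEquivalence)
import Relation.Binary.Reasoning.Setoid as SetoidReasoning
open import Algebra.Bundles using (CommutativeRing)
open import Algebra.Structures using (IsCommutativeRing)
import Algebra.Properties.Ring as RingProperties
import Algebra.Properties.CommutativeSemigroup as CommutativeSemigroupProperties
open import Algebra.Solver.Ring.AlmostCommutativeRing
  using (AlmostCommutativeRing; _-Raw-AlmostCommutative⟶_; fromCommutativeRing)
import Algebra.Solver.Ring as RingSolver

AllPairs-mapWithAll : ∀ {X : Set} {Q : X → Set} {R S : X → X → Set} {L : List X} →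
                      (∀ {x y} → Q x → Q y → R x y → S x y) → All Q L → AllPairs R L → AllPairs S L
AllPairs-mapWithAll f []       []       = []
AllPairs-mapWithAll f (q ∷ qs) (r ∷ rs) = All.zipWith (λ (q′ , r′) → f q q′ r′) (qs , r) ∷ AllPairs-mapWithAll f qs rs

-- The ring solver needs decidable equality of coefficients to cancel terms, so
-- identities in an arbitrary commutative ring are solved with coefficients in ℤ.
module IntegerSolver (R : CommutativeRing 0ℓ 0ℓ) where

  open Data.Integer using (+_; -[1+_])
  open CommutativeRing R
  open RingProperties ring using (-0#≈0#; -‿involutive; -‿distribˡ-*; -‿+-comm)
  open CommutativeSemigroupProperties *-commutativeSemigroup using (interchange)
  open SetoidReasoning setoid

  natR-+ : ∀ m n → natR R (m ℕ.+ n) ≈ natR R m + natR R n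
  natR-+ zero    n = sym (+-identityˡ _)
  natR-+ (suc m) n = trans (+-congˡ (natR-+ m n)) (sym (+-assoc _ _ _))

  natR-* : ∀ m n → natR R (m ℕ.* n) ≈ natR R m * natR R n
  natR-* zero    n = sym (zeroˡ _)
  natR-* (suc m) n = begin
    natR R (n ℕ.+ m ℕ.* n)            ≈⟨ natR-+ n (m ℕ.* n) ⟩
    natR R n + natR R (m ℕ.* n)        ≈⟨ +-cong (sym (*-identityˡ _)) (natR-* m n) ⟩
    1# * natR R n + natR R m * natR R n ≈⟨ sym (distribʳ _ _ _) ⟩
    (1# + natR R m) * natR R n         ∎

  private
    1+x-[1+y]≈x-y : ∀ x y → (1# + x) - (1# + y) ≈ x - y
    1+x-[1+y]≈x-y x y = begin
      (1# + x) - (1# + y)       ≈⟨ +-congˡ (sym (-‿+-comm 1# y)) ⟩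
      (1# + x) + (- 1# - y)     ≈⟨ +-assoc _ _ _ ⟩
      1# + (x + (- 1# - y))     ≈⟨ +-congˡ (sym (+-assoc _ _ _)) ⟩
      1# + ((x - 1#) - y)       ≈⟨ +-congˡ (+-congʳ (+-comm _ _)) ⟩
      1# + ((- 1# + x) - y)     ≈⟨ +-congˡ (+-assoc _ _ _) ⟩
      1# + (- 1# + (x - y))     ≈⟨ sym (+-assoc _ _ _) ⟩
      (1# - 1#) + (x - y)       ≈⟨ +-congʳ (-‿inverseʳ 1#) ⟩
      0# + (x - y)              ≈⟨ +-identityˡ _ ⟩
      x - y                     ∎

  intR-⊖ : ∀ m n → intR R (m ℤ.⊖ n) ≈ natR R m - natR R n
  intR-⊖ m zero = begin
    intR R (m ℤ.⊖ 0)   ≡⟨ ≡.cong (intR R) (ℤP.⊖-≥ {m} {0} z≤n) ⟩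
    natR R m           ≈⟨ sym (+-identityʳ _) ⟩
    natR R m + 0#      ≈⟨ +-congˡ (sym -0#≈0#) ⟩
    natR R m - 0#      ∎
  intR-⊖ zero (suc n) = begin
    intR R (0 ℤ.⊖ suc n)   ≡⟨ ≡.cong (intR R) (ℤP.⊖-< {0} {suc n} (s≤s z≤n)) ⟩
    - natR R (suc n)       ≈⟨ sym (+-identityˡ _) ⟩
    0# - natR R (suc n)    ∎
  intR-⊖ (suc m) (suc n) = begin
    intR R (suc m ℤ.⊖ suc n)  ≡⟨ ≡.cong (intR R) (ℤP.[1+m]⊖[1+n]≡m⊖n m n) ⟩
    intR R (m ℤ.⊖ n)          ≈⟨ intR-⊖ m n ⟩
    natR R m - natR R n       ≈⟨ sym (1+x-[1+y]≈x-y _ _) ⟩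
    natR R (suc m) - natR R (suc n) ∎

  intR-+ : ∀ i j → intR R (i ℤ.+ j) ≈ intR R i + intR R j
  intR-+ -[1+ m ] -[1+ n ] = begin
    - natR R (suc (suc (m ℕ.+ n)))       ≡⟨ ≡.cong (λ k → - natR R (suc k)) (≡.sym (ℕP.+-suc m n)) ⟩
    - natR R (suc m ℕ.+ suc n)           ≈⟨ -‿cong (natR-+ (suc m) (suc n)) ⟩
    - (natR R (suc m) + natR R (suc n))  ≈⟨ sym (-‿+-comm _ _) ⟩
    - natR R (suc m) + - natR R (suc n)  ∎
  intR-+ -[1+ m ] (+ n) = trans (intR-⊖ n (suc m)) (+-comm _ _)
  intR-+ (+ m) -[1+ n ] = intR-⊖ m (suc n)
  intR-+ (+ m) (+ n)    = natR-+ m n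

  intR-neg : ∀ i → intR R (ℤ.- i) ≈ - intR R i
  intR-neg -[1+ n ]   = sym (-‿involutive _)
  intR-neg (+ zero)   = sym -0#≈0#
  intR-neg (+ suc n)  = refl

  private
    signR : Sign → Carrier
    signR Sign.+ = 1#
    signR Sign.- = - 1#

    -x≈-1*x : ∀ x → - x ≈ - 1# * x
    -x≈-1*x x = trans (-‿cong (sym (*-identityˡ x))) (-‿distribˡ-* 1# x)

    intR-◃ : ∀ s k → intR R (s ℤ.◃ k) ≈ signR s * natR R k
    intR-◃ s        zero    = sym (zeroʳ _)
    intR-◃ Sign.+ (suc k) = sym (*-identityˡ _)
    intR-◃ Sign.- (suc k) = -x≈-1*x _

    intR-sign : ∀ i → intR R i ≈ signR (ℤ.sign i) * natR R ℤ.∣ i ∣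
    intR-sign -[1+ n ] = -x≈-1*x _
    intR-sign (+ n)    = sym (*-identityˡ _)

    signR-* : ∀ s t → signR (s Sign.* t) ≈ signR s * signR t
    signR-* Sign.- Sign.- = sym (trans (sym (-x≈-1*x (- 1#))) (-‿involutive 1#))
    signR-* Sign.- Sign.+ = sym (*-identityʳ _)
    signR-* Sign.+ Sign.- = sym (*-identityˡ _)
    signR-* Sign.+ Sign.+ = sym (*-identityˡ _)

  intR-* : ∀ i j → intR R (i ℤ.* j) ≈ intR R i * intR R j
  intR-* i j = begin
    intR R (i ℤ.* j)
      ≈⟨ intR-◃ (ℤ.sign i Sign.* ℤ.sign j) (ℤ.∣ i ∣ ℕ.* ℤ.∣ j ∣) ⟩
    signR (ℤ.sign i Sign.* ℤ.sign j) * natR R (ℤ.∣ i ∣ ℕ.* ℤ.∣ j ∣)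
      ≈⟨ *-cong (signR-* (ℤ.sign i) (ℤ.sign j)) (natR-* ℤ.∣ i ∣ ℤ.∣ j ∣) ⟩
    (signR (ℤ.sign i) * signR (ℤ.sign j)) * (natR R ℤ.∣ i ∣ * natR R ℤ.∣ j ∣)
      ≈⟨ interchange _ _ _ _ ⟩
    (signR (ℤ.sign i) * natR R ℤ.∣ i ∣) * (signR (ℤ.sign j) * natR R ℤ.∣ j ∣)
      ≈⟨ sym (*-cong (intR-sign i) (intR-sign j)) ⟩
    intR R i * intR R j ∎

  private
    R′ : AlmostCommutativeRing 0ℓ 0ℓ
    R′ = fromCommutativeRing R

    intR-homomorphism : CommutativeRing.rawRing ℤP.+-*-commutativeRing -Raw-AlmostCommutative⟶ R′
    intR-homomorphism = record
      { ⟦_⟧    = intR R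
      ; +-homo = intR-+
      ; *-homo = intR-*
      ; -‿homo = intR-neg
      ; 0-homo = refl
      ; 1-homo = +-identityʳ 1#
      }

    intR-≟ : ∀ i j → Maybe (intR R i ≈ intR R j)
    intR-≟ i j with i ℤ.≟ j
    ... | yes ≡.refl = just refl
    ... | no _       = nothing

  open RingSolver (CommutativeRing.rawRing ℤP.+-*-commutativeRing) R′ intR-homomorphism intR-≟ public

module FiniteSums (R : CommutativeRing 0ℓ 0ℓ) where
  open Data.Integer using (+_)
  open CommutativeRing R
  open RingProperties ring using (-0#≈0#; -‿+-comm; -‿distribˡ-*)
  open SetoidReasoning setoid
  open IntegerSolver R using (solve; _:+_; _:*_; :-_; _:=_; intR-*)

  x-0#≈x : ∀ x → x - 0# ≈ x
  x-0#≈x x = trans (+-congˡ -0#≈0#) (+-identityʳ x)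

  ∑ : ∀ {X : Set} → List X → (X → Carrier) → Carrier
  ∑ L f = sumR R (map f L)

  ∏ : ∀ {X : Set} → List X → (X → Carrier) → Carrier
  ∏ L f = foldr _*_ 1# (map f L)

  module _ {X : Set} where

    ∑-cong : ∀ (L : List X) {f g} → (∀ x → f x ≈ g x) → ∑ L f ≈ ∑ L g
    ∑-cong [] h = refl
    ∑-cong (x ∷ L) h = +-cong (h x) (∑-cong L h)

    ∑-cong-All : ∀ {Q : X → Set} (L : List X) {f g} → All Q L → (∀ x → Q x → f x ≈ g x) → ∑ L f ≈ ∑ L g
    ∑-cong-All [] _ h = refl
    ∑-cong-All (x ∷ L) (q ∷ qs) h = +-cong (h x q) (∑-cong-All L qs h)

    ∑-+ : ∀ (L : List X) (f g : X → Carrier) → ∑ L (λ x → f x + g x) ≈ ∑ L f + ∑ L g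
    ∑-+ [] f g = sym (+-identityˡ 0#)
    ∑-+ (x ∷ L) f g = trans (+-congˡ (∑-+ L f g)) (solve 4 (λ a b c d → (a :+ b) :+ (c :+ d) := (a :+ c) :+ (b :+ d)) refl (f x) (g x) (∑ L f) (∑ L g))

    ∑-* : ∀ (L : List X) c (f : X → Carrier) → ∑ L (λ x → c * f x) ≈ c * ∑ L f
    ∑-* [] c f = sym (zeroʳ c)
    ∑-* (x ∷ L) c f = trans (+-congˡ (∑-* L c f)) (sym (distribˡ c _ _))

    ∑-neg : ∀ (L : List X) (f : X → Carrier) → ∑ L (λ x → - f x) ≈ - ∑ L f
    ∑-neg [] f = sym -0#≈0#
    ∑-neg (x ∷ L) f = trans (+-congˡ (∑-neg L f)) (-‿+-comm _ _)

    ∑-- : ∀ (L : List X) (f g : X → Carrier) → ∑ L (λ x → f x - g x) ≈ ∑ L f - ∑ L g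
    ∑-- L f g = trans (∑-+ L f (λ x → - g x)) (+-congˡ (∑-neg L g))

    ∑-0# : ∀ (L : List X) → ∑ L (λ _ → 0#) ≈ 0#
    ∑-0# [] = refl
    ∑-0# (x ∷ L) = trans (+-congˡ (∑-0# L)) (+-identityˡ 0#)

    ∑-1# : ∀ (L : List X) → ∑ L (λ _ → 1#) ≈ natR R (length L)
    ∑-1# [] = refl
    ∑-1# (x ∷ L) = +-congˡ (∑-1# L)

    ∏-cong : ∀ (L : List X) {f g} → (∀ x → f x ≈ g x) → ∏ L f ≈ ∏ L g
    ∏-cong [] h = refl
    ∏-cong (x ∷ L) h = *-cong (h x) (∏-cong L h)

    ∏-* : ∀ (L : List X) (f g : X → Carrier) → ∏ L (λ x → f x * g x) ≈ ∏ L f * ∏ L g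
    ∏-* [] f g = sym (*-identityˡ 1#)
    ∏-* (x ∷ L) f g = trans (*-congˡ (∏-* L f g)) (solve 4 (λ a b c d → (a :* b) :* (c :* d) := (a :* c) :* (b :* d)) refl (f x) (g x) (∏ L f) (∏ L g))

    ∏-1# : ∀ (L : List X) → ∏ L (λ _ → 1#) ≈ 1#
    ∏-1# [] = refl
    ∏-1# (x ∷ L) = trans (*-congˡ (∏-1# L)) (*-identityˡ 1#)

  module _ {X Y : Set} where
    ∑-swap : ∀ (L1 : List X) (L2 : List Y) (f : X → Y → Carrier) → ∑ L1 (λ x → ∑ L2 (f x)) ≈ ∑ L2 (λ y → ∑ L1 (λ x → f x y))
    ∑-swap [] L2 f = sym (∑-0# L2)
    ∑-swap (x ∷ L1) L2 f = trans (+-congˡ (∑-swap L1 L2 f)) (sym (∑-+ L2 (f x) (λ y → ∑ L1 (λ x → f x y))))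

    ∏-swap : ∀ (L1 : List X) (L2 : List Y) (f : X → Y → Carrier) → ∏ L1 (λ x → ∏ L2 (f x)) ≈ ∏ L2 (λ y → ∏ L1 (λ x → f x y))
    ∏-swap [] L2 f = sym (∏-1# L2)
    ∏-swap (x ∷ L1) L2 f = trans (*-congˡ (∏-swap L1 L2 f)) (sym (∏-* L2 (f x) (λ y → ∏ L1 (λ x → f x y))))

  ∏-cong-All : ∀ {X : Set} {Q : X → Set} (L : List X) {f g : X → Carrier} → All Q L → (∀ x → Q x → f x ≈ g x) → ∏ L f ≈ ∏ L g
  ∏-cong-All []      _        _   = refl
  ∏-cong-All (x ∷ L) (q ∷ qs) f≈g = *-cong (f≈g x q) (∏-cong-All L qs f≈g)

  ∏-≈0# : ∀ {X : Set} (L : List X) {f : X → Carrier} → Any (λ x → f x ≈ 0#) L → ∏ L f ≈ 0#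
  ∏-≈0# (x ∷ L) (here fx≈0) = trans (*-congʳ fx≈0) (zeroˡ _)
  ∏-≈0# (x ∷ L) (there any) = trans (*-congˡ (∏-≈0# L any)) (zeroʳ _)

  ∑-≈0# : ∀ {X : Set} (L : List X) {f : X → Carrier} → (∀ x → f x ≈ 0#) → ∑ L f ≈ 0#
  ∑-≈0# L f≈0 = trans (∑-cong L f≈0) (∑-0# L)

  ind₀ : ∀ {A : Set} → Dec A → Carrier → Carrier
  ind₀ (yes _) v = v
  ind₀ (no _) v = 0#

  ind₁ : ∀ {A : Set} → Dec A → Carrier → Carrier
  ind₁ (yes _) v = v
  ind₁ (no _) v = 1#

  ind₀-yes : ∀ {A : Set} (d : Dec A) v → A → ind₀ d v ≈ v
  ind₀-yes (yes _) v _ = refl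
  ind₀-yes (no n) v a = ⊥-elim (n a)

  ind₀-no : ∀ {A : Set} (d : Dec A) v → ¬ A → ind₀ d v ≈ 0#
  ind₀-no (yes a) v n = ⊥-elim (n a)
  ind₀-no (no _) v _ = refl

  ind₁-yes : ∀ {A : Set} (d : Dec A) v → A → ind₁ d v ≈ v
  ind₁-yes (yes _) v _ = refl
  ind₁-yes (no n) v a = ⊥-elim (n a)

  ind₁-no : ∀ {A : Set} (d : Dec A) v → ¬ A → ind₁ d v ≈ 1#
  ind₁-no (yes a) v n = ⊥-elim (n a)
  ind₁-no (no _) v _ = refl

  ind₀-cong : ∀ {A : Set} (d : Dec A) {v w} → v ≈ w → ind₀ d v ≈ ind₀ d w
  ind₀-cong (yes _) e = e
  ind₀-cong (no _) e = refl

  ind₀-≈0# : ∀ {A : Set} (d : Dec A) {v} → (A → v ≈ 0#) → ind₀ d v ≈ 0#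
  ind₀-≈0# (yes a) v≈0 = v≈0 a
  ind₀-≈0# (no _)  _   = refl

  ind₀-⇔ : ∀ {A B : Set} (a? : Dec A) (b? : Dec B) {v w} → (A → B) → (B → A) → v ≈ w → ind₀ a? v ≈ ind₀ b? w
  ind₀-⇔ (yes _) (yes _) _   _   v≈w = v≈w
  ind₀-⇔ (yes a) (no ¬b) A⇒B _   _   = ⊥-elim (¬b (A⇒B a))
  ind₀-⇔ (no ¬a) (yes b) _   B⇒A _   = ⊥-elim (¬a (B⇒A b))
  ind₀-⇔ (no _)  (no _)  _   _   _   = refl

  AtMostOne : ∀ {X : Set} → (X → Set) → List X → Set
  AtMostOne p = AllPairs (λ x y → p x → p y → ⊥)

  module _ {X : Set} {p : X → Set} (p? : ∀ x → Dec (p x)) where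

    private
      others : ∀ {x L} → p x → All (λ y → p x → p y → ⊥) L → All (λ y → ¬ p y) L
      others px = All.map (λ ¬both → ¬both px)

      ¬Any : ∀ {x L} → p x → Any p L → All (λ y → p x → p y → ⊥) L → ⊥
      ¬Any px any ¬both = All.lookupWith (λ ¬b py → ¬b px py) ¬both any

    ∑-ind₀-none : ∀ (L : List X) (g : X → Carrier) → All (λ x → ¬ p x) L → ∑ L (λ x → ind₀ (p? x) (g x)) ≈ 0#
    ∑-ind₀-none []      g _          = refl
    ∑-ind₀-none (x ∷ L) g (¬px ∷ ¬ps) = trans (+-cong (ind₀-no (p? x) (g x) ¬px) (∑-ind₀-none L g ¬ps)) (+-identityˡ 0#)

    ∑-ind₀-unique : ∀ (L : List X) (g : X → Carrier) c → (∀ x → p x → g x ≈ c) → AtMostOne p L → Any p L →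
                    ∑ L (λ x → ind₀ (p? x) (g x)) ≈ c
    ∑-ind₀-unique (x ∷ L) g c g≈c (h ∷ hs) (here px) =
      trans (+-cong (trans (ind₀-yes (p? x) (g x) px) (g≈c x px)) (∑-ind₀-none L g (others px h))) (+-identityʳ c)
    ∑-ind₀-unique (x ∷ L) g c g≈c (h ∷ hs) (there any) with p? x
    ... | yes px = ⊥-elim (¬Any px any h)
    ... | no  _  = trans (+-identityˡ _) (∑-ind₀-unique L g c g≈c hs any)

    ∏-ind₁-none : ∀ (L : List X) (g : X → Carrier) → All (λ x → ¬ p x) L → ∏ L (λ x → ind₁ (p? x) (g x)) ≈ 1#
    ∏-ind₁-none []      g _          = refl
    ∏-ind₁-none (x ∷ L) g (¬px ∷ ¬ps) = trans (*-cong (ind₁-no (p? x) (g x) ¬px) (∏-ind₁-none L g ¬ps)) (*-identityˡ 1#)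

    ∏-ind₁-unique : ∀ (L : List X) (g : X → Carrier) c → (∀ x → p x → g x ≈ c) → AtMostOne p L → Any p L →
                    ∏ L (λ x → ind₁ (p? x) (g x)) ≈ c
    ∏-ind₁-unique (x ∷ L) g c g≈c (h ∷ hs) (here px) =
      trans (*-cong (trans (ind₁-yes (p? x) (g x) px) (g≈c x px)) (∏-ind₁-none L g (others px h))) (*-identityʳ c)
    ∏-ind₁-unique (x ∷ L) g c g≈c (h ∷ hs) (there any) with p? x
    ... | yes px = ⊥-elim (¬Any px any h)
    ... | no  _  = trans (*-identityˡ _) (∏-ind₁-unique L g c g≈c hs any)

  sgn : ℕ → Carrier
  sgn zero = 1#
  sgn (suc k) = - sgn k

  sgn*sgn≈1 : ∀ k → sgn k * sgn k ≈ 1#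
  sgn*sgn≈1 zero = *-identityˡ 1#
  sgn*sgn≈1 (suc k) = trans (solve 1 (λ s → (:- s) :* (:- s) := s :* s) refl (sgn k)) (sgn*sgn≈1 k)

  intR-[-1]^ : ∀ k → intR R ((ℤ.- (+ 1)) ℤ.^ k) ≈ sgn k
  intR-[-1]^ zero = +-identityʳ 1#
  intR-[-1]^ (suc k) = begin
    intR R ((ℤ.- (+ 1)) ℤ.* (ℤ.- (+ 1)) ℤ.^ k)  ≈⟨ intR-* (ℤ.- (+ 1)) ((ℤ.- (+ 1)) ℤ.^ k) ⟩
    - (1# + 0#) * intR R ((ℤ.- (+ 1)) ℤ.^ k)   ≈⟨ *-cong (-‿cong (+-identityʳ 1#)) (intR-[-1]^ k) ⟩
    - 1# * sgn k                               ≈⟨ sym (-‿distribˡ-* 1# (sgn k)) ⟩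
    - (1# * sgn k)                             ≈⟨ -‿cong (*-identityˡ (sgn k)) ⟩
    - sgn k                                    ∎

  module _ {X Y : Set} where
    ∑-reindex : ∀ (L1 : List X) (L2 : List Y) (φ : X → Y → Carrier) (f : X → Carrier) (h : Y → Carrier) →
              All (λ x → ∑ L2 (φ x) ≈ f x) L1 → All (λ y → ∑ L1 (λ x → φ x y) ≈ h y) L2 → ∑ L1 f ≈ ∑ L2 h
    ∑-reindex L1 L2 φ f h a1 a2 = begin
      ∑ L1 f                                   ≈⟨ ∑-cong-All L1 a1 (λ x e → sym e) ⟩
      ∑ L1 (λ x → ∑ L2 (φ x))                  ≈⟨ ∑-swap L1 L2 φ ⟩
      ∑ L2 (λ y → ∑ L1 (λ x → φ x y))          ≈⟨ ∑-cong-All L2 a2 (λ y e → e) ⟩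
      ∑ L2 h                                   ∎

  module _ {X Y : Set} {Rel : X → Y → Set} (Rel? : ∀ x y → Dec (Rel x y)) where

    ∑-matching : ∀ (L₁ : List X) (L₂ : List Y) (f : X → Carrier) (h : Y → Carrier) →
                 (∀ {x y} → Rel x y → f x ≈ h y) →
                 All (λ x → AtMostOne (Rel x) L₂ × (Any (Rel x) L₂ ⊎ f x ≈ 0#)) L₁ →
                 All (λ y → AtMostOne (λ x → Rel x y) L₁ × (Any (λ x → Rel x y) L₁ ⊎ h y ≈ 0#)) L₂ →
                 ∑ L₁ f ≈ ∑ L₂ h
    ∑-matching L₁ L₂ f h f≈h matched₁ matched₂ = ∑-reindex L₁ L₂ φ f h (All.map row matched₁) (All.map column matched₂)
      where
      φ : X → Y → Carrier
      φ x y = ind₀ (Rel? x y) (f x)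
      row : ∀ {x} → AtMostOne (Rel x) L₂ × (Any (Rel x) L₂ ⊎ f x ≈ 0#) → ∑ L₂ (φ x) ≈ f x
      row {x} (≤1 , inj₁ any)  = ∑-ind₀-unique (Rel? x) L₂ (λ _ → f x) (f x) (λ _ _ → refl) ≤1 any
      row {x} (_  , inj₂ fx≈0) = trans (∑-≈0# L₂ (λ y → ind₀-≈0# (Rel? x y) (λ _ → fx≈0))) (sym fx≈0)
      column : ∀ {y} → AtMostOne (λ x → Rel x y) L₁ × (Any (λ x → Rel x y) L₁ ⊎ h y ≈ 0#) → ∑ L₁ (λ x → φ x y) ≈ h y
      column {y} (≤1 , inj₁ any)  = ∑-ind₀-unique (λ x → Rel? x y) L₁ f (h y) (λ _ → f≈h) ≤1 any
      column {y} (_  , inj₂ hy≈0) = trans (∑-≈0# L₁ (λ x → ind₀-≈0# (Rel? x y) (λ r → trans (f≈h r) hy≈0))) (sym hy≈0)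

module PolyRing (𝔽 : FiniteField) where
  open ≡

  open FiniteField 𝔽
  open Polynomials 𝔽
  open IsCommutativeRing isCommutativeRing using
    (+-comm; +-assoc; *-comm; *-assoc; +-identityˡ; +-identityʳ; *-identityˡ;

     zeroˡ; zeroʳ; distribˡ; distribʳ; -‿inverseʳ)

  field-commutativeRing : CommutativeRing 0ℓ 0ℓ
  field-commutativeRing = record { isCommutativeRing = isCommutativeRing }

  -0#≡0# : - 0# ≡ 0#
  -0#≡0# = trans (sym (+-identityˡ (- 0#))) (-‿inverseʳ 0#)

  -- A record wrapper around _≈ₚ_, so that both polynomials can be inferred from a proof.
  infix 4 _≋_
  record _≋_ (A B : Poly) : Set where
    constructor ⟨_⟩
    field coeff-≡ : A ≈ₚ B
  open _≋_ public

  ≋-refl : ∀ {A} → A ≋ A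
  ≋-refl = ⟨ (λ _ → refl) ⟩

  ≋-sym : ∀ {A B} → A ≋ B → B ≋ A
  ≋-sym ⟨ p ⟩ = ⟨ (λ i → sym (p i)) ⟩

  ≋-trans : ∀ {A B C} → A ≋ B → B ≋ C → A ≋ C
  ≋-trans ⟨ p ⟩ ⟨ q ⟩ = ⟨ (λ i → trans (p i) (q i)) ⟩

  ≋-isEquivalence : IsEquivalence _≋_
  ≋-isEquivalence = record { refl = ≋-refl ; sym = ≋-sym ; trans = ≋-trans }

  ∷-cong : ∀ {a b A B} → a ≡ b → A ≋ B → (a ∷ A) ≋ (b ∷ B)
  ∷-cong p ⟨ q ⟩ = ⟨ (λ { zero → p ; (suc i) → q i }) ⟩

  ∷-injective : ∀ {a b A B} → (a ∷ A) ≋ (b ∷ B) → a ≡ b × A ≋ B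
  ∷-injective ⟨ p ⟩ = p zero , ⟨ (λ i → p (suc i)) ⟩

  ∷≋[]⇒ : ∀ {a A} → (a ∷ A) ≋ [] → a ≡ 0# × A ≋ []
  ∷≋[]⇒ ⟨ p ⟩ = p zero , ⟨ (λ i → p (suc i)) ⟩

  0∷[]≋[] : (0# ∷ []) ≋ []
  0∷[]≋[] = ⟨ (λ { zero → refl ; (suc i) → refl }) ⟩

  coeff-+ₚ : ∀ A B i → coeff (A +ₚ B) i ≡ coeff A i + coeff B i
  coeff-+ₚ []      B       i       = sym (+-identityˡ _)
  coeff-+ₚ (a ∷ A) []      i       = sym (+-identityʳ _)
  coeff-+ₚ (a ∷ A) (b ∷ B) zero    = refl
  coeff-+ₚ (a ∷ A) (b ∷ B) (suc i) = coeff-+ₚ A B i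

  coeff-negₚ : ∀ A i → coeff (negₚ A) i ≡ - coeff A i
  coeff-negₚ []      i       = sym -0#≡0#
  coeff-negₚ (a ∷ A) zero    = refl
  coeff-negₚ (a ∷ A) (suc i) = coeff-negₚ A i

  coeff-scale : ∀ c A i → coeff (scale c A) i ≡ c * coeff A i
  coeff-scale c []      i       = sym (zeroʳ c)
  coeff-scale c (a ∷ A) zero    = refl
  coeff-scale c (a ∷ A) (suc i) = coeff-scale c A i

  +ₚ-cong : ∀ {A A' B B'} → A ≋ A' → B ≋ B' → (A +ₚ B) ≋ (A' +ₚ B')
  +ₚ-cong {A} {A'} {B} {B'} ⟨ p ⟩ ⟨ q ⟩ =
    ⟨ (λ i → trans (coeff-+ₚ A B i) (trans (cong₂ _+_ (p i) (q i)) (sym (coeff-+ₚ A' B' i)))) ⟩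

  negₚ-cong : ∀ {A A'} → A ≋ A' → negₚ A ≋ negₚ A'
  negₚ-cong {A} {A'} ⟨ p ⟩ = ⟨ (λ i → trans (coeff-negₚ A i) (trans (cong -_ (p i)) (sym (coeff-negₚ A' i)))) ⟩

  scale-congʳ : ∀ {c A A'} → A ≋ A' → scale c A ≋ scale c A'
  scale-congʳ {c} {A} {A'} ⟨ p ⟩ = ⟨ (λ i → trans (coeff-scale c A i) (trans (cong (c *_) (p i)) (sym (coeff-scale c A' i)))) ⟩

  scale-congˡ : ∀ {c d} A → c ≡ d → scale c A ≋ scale d A
  scale-congˡ A refl = ≋-refl

  +ₚ-comm : ∀ A B → (A +ₚ B) ≋ (B +ₚ A)
  +ₚ-comm A B = ⟨ (λ i → trans (coeff-+ₚ A B i) (trans (+-comm _ _) (sym (coeff-+ₚ B A i)))) ⟩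

  +ₚ-assoc : ∀ A B C → ((A +ₚ B) +ₚ C) ≋ (A +ₚ (B +ₚ C))
  +ₚ-assoc A B C = ⟨ (λ i → trans (coeff-+ₚ (A +ₚ B) C i) (trans (cong (_+ coeff C i) (coeff-+ₚ A B i))
    (trans (+-assoc _ _ _) (trans (cong (coeff A i +_) (sym (coeff-+ₚ B C i))) (sym (coeff-+ₚ A (B +ₚ C) i)))))) ⟩

  +ₚ-identityˡ : ∀ A → ([] +ₚ A) ≋ A
  +ₚ-identityˡ A = ≋-refl

  +ₚ-identityʳ : ∀ A → (A +ₚ []) ≋ A
  +ₚ-identityʳ A = ⟨ (λ i → trans (coeff-+ₚ A [] i) (+-identityʳ _)) ⟩

  +ₚ-inverseʳ : ∀ A → (A +ₚ negₚ A) ≋ []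
  +ₚ-inverseʳ A = ⟨ (λ i → trans (coeff-+ₚ A (negₚ A) i) (trans (cong (coeff A i +_) (coeff-negₚ A i)) (-‿inverseʳ _))) ⟩

  +ₚ-inverseˡ : ∀ A → (negₚ A +ₚ A) ≋ []
  +ₚ-inverseˡ A = ≋-trans (+ₚ-comm (negₚ A) A) (+ₚ-inverseʳ A)

  +ₚ-left-comm : ∀ X Y Z → (X +ₚ (Y +ₚ Z)) ≋ (Y +ₚ (X +ₚ Z))
  +ₚ-left-comm X Y Z = ≋-trans (≋-sym (+ₚ-assoc X Y Z)) (≋-trans (+ₚ-cong (+ₚ-comm X Y) ≋-refl) (+ₚ-assoc Y X Z))

  +ₚ-interchange : ∀ X Y Z W → ((X +ₚ Y) +ₚ (Z +ₚ W)) ≋ ((X +ₚ Z) +ₚ (Y +ₚ W))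
  +ₚ-interchange X Y Z W = ≋-trans (+ₚ-assoc X Y (Z +ₚ W))
    (≋-trans (+ₚ-cong (≋-refl {X}) (+ₚ-left-comm Y Z W)) (≋-sym (+ₚ-assoc X Z (Y +ₚ W))))

  0∷-+ₚ : ∀ X Y → (0# ∷ (X +ₚ Y)) ≋ ((0# ∷ X) +ₚ (0# ∷ Y))
  0∷-+ₚ X Y = ∷-cong (sym (+-identityʳ 0#)) ≋-refl

  scale-distribˡ : ∀ c A B → scale c (A +ₚ B) ≋ (scale c A +ₚ scale c B)
  scale-distribˡ c A B = ⟨ (λ i → trans (coeff-scale c (A +ₚ B) i) (trans (cong (c *_) (coeff-+ₚ A B i))
    (trans (distribˡ c _ _) (sym (trans (coeff-+ₚ (scale c A) (scale c B) i) (cong₂ _+_ (coeff-scale c A i) (coeff-scale c B i))))))) ⟩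

  scale-distribʳ : ∀ c d A → scale (c + d) A ≋ (scale c A +ₚ scale d A)
  scale-distribʳ c d A = ⟨ (λ i → trans (coeff-scale (c + d) A i)
    (trans (distribʳ (coeff A i) c d) (sym (trans (coeff-+ₚ (scale c A) (scale d A) i) (cong₂ _+_ (coeff-scale c A i) (coeff-scale d A i)))))) ⟩

  scale-assoc : ∀ c d A → scale (c * d) A ≋ scale c (scale d A)
  scale-assoc c d A = ⟨ (λ i → trans (coeff-scale (c * d) A i)
    (trans (*-assoc c d _) (sym (trans (coeff-scale c (scale d A) i) (cong (c *_) (coeff-scale d A i)))))) ⟩

  scale-0# : ∀ A → scale 0# A ≋ []
  scale-0# A = ⟨ (λ i → trans (coeff-scale 0# A i) (zeroˡ _)) ⟩

  scale-1# : ∀ A → scale 1# A ≋ A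
  scale-1# A = ⟨ (λ i → trans (coeff-scale 1# A i) (*-identityˡ _)) ⟩

  scale-0∷ : ∀ c X → scale c (0# ∷ X) ≋ (0# ∷ scale c X)
  scale-0∷ c X = ∷-cong (zeroʳ c) ≋-refl

  scale-≡0# : ∀ c A → c ≡ 0# → scale c A ≋ []
  scale-≡0# c A refl = scale-0# A

  *ₚ-zeroˡ : ∀ A B → A ≋ [] → (A *ₚ B) ≋ []
  *ₚ-zeroˡ [] B p = ≋-refl
  *ₚ-zeroˡ (a ∷ A) B p with ∷≋[]⇒ p
  ... | a0 , A0 = ≋-trans (+ₚ-cong (scale-≡0# a B a0) (≋-trans (∷-cong refl (*ₚ-zeroˡ A B A0)) 0∷[]≋[])) ≋-refl

  *ₚ-congˡ : ∀ {A A'} B → A ≋ A' → (A *ₚ B) ≋ (A' *ₚ B)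
  *ₚ-congˡ {[]} {[]} B p = ≋-refl
  *ₚ-congˡ {[]} {a' ∷ A'} B p = ≋-sym (*ₚ-zeroˡ (a' ∷ A') B (≋-sym p))
  *ₚ-congˡ {a ∷ A} {[]} B p = *ₚ-zeroˡ (a ∷ A) B p
  *ₚ-congˡ {a ∷ A} {a' ∷ A'} B p with ∷-injective p
  ... | refl , q = +ₚ-cong ≋-refl (∷-cong refl (*ₚ-congˡ B q))

  *ₚ-congʳ : ∀ A {B B'} → B ≋ B' → (A *ₚ B) ≋ (A *ₚ B')
  *ₚ-congʳ [] p = ≋-refl
  *ₚ-congʳ (a ∷ A) p = +ₚ-cong (scale-congʳ p) (∷-cong refl (*ₚ-congʳ A p))

  *ₚ-cong : ∀ {A A' B B'} → A ≋ A' → B ≋ B' → (A *ₚ B) ≋ (A' *ₚ B')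
  *ₚ-cong {A} {A'} {B} {B'} p q = ≋-trans (*ₚ-congˡ B p) (*ₚ-congʳ A' q)

  *ₚ-zeroʳ : ∀ A → (A *ₚ []) ≋ []
  *ₚ-zeroʳ [] = ≋-refl
  *ₚ-zeroʳ (a ∷ A) = ≋-trans (∷-cong refl (*ₚ-zeroʳ A)) 0∷[]≋[]

  *ₚ-distribˡ : ∀ A B C → (A *ₚ (B +ₚ C)) ≋ ((A *ₚ B) +ₚ (A *ₚ C))
  *ₚ-distribˡ [] B C = ≋-refl
  *ₚ-distribˡ (a ∷ A) B C =
    ≋-trans (+ₚ-cong (scale-distribˡ a B C) (≋-trans (∷-cong refl (*ₚ-distribˡ A B C)) (0∷-+ₚ (A *ₚ B) (A *ₚ C))))
            (+ₚ-interchange (scale a B) (scale a C) (0# ∷ (A *ₚ B)) (0# ∷ (A *ₚ C)))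

  *ₚ-distribʳ : ∀ A B C → ((A +ₚ B) *ₚ C) ≋ ((A *ₚ C) +ₚ (B *ₚ C))
  *ₚ-distribʳ [] B C = ≋-refl
  *ₚ-distribʳ (a ∷ A) [] C = ≋-sym (+ₚ-identityʳ _)
  *ₚ-distribʳ (a ∷ A) (b ∷ B) C =
    ≋-trans (+ₚ-cong (scale-distribʳ a b C) (≋-trans (∷-cong refl (*ₚ-distribʳ A B C)) (0∷-+ₚ (A *ₚ C) (B *ₚ C))))
            (+ₚ-interchange (scale a C) (scale b C) (0# ∷ (A *ₚ C)) (0# ∷ (B *ₚ C)))

  0∷-*ₚ : ∀ X B → ((0# ∷ X) *ₚ B) ≋ (0# ∷ (X *ₚ B))
  0∷-*ₚ X B = +ₚ-cong (scale-0# B) ≋-refl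

  scale-*ₚ : ∀ c A B → (scale c A *ₚ B) ≋ scale c (A *ₚ B)
  scale-*ₚ c [] B = ≋-refl
  scale-*ₚ c (a ∷ A) B =
    ≋-trans (+ₚ-cong (scale-assoc c a B) (∷-cong refl (scale-*ₚ c A B)))
    (≋-trans (+ₚ-cong ≋-refl (≋-sym (scale-0∷ c (A *ₚ B)))) (≋-sym (scale-distribˡ c (scale a B) (0# ∷ (A *ₚ B)))))

  *ₚ-assoc : ∀ A B C → ((A *ₚ B) *ₚ C) ≋ (A *ₚ (B *ₚ C))
  *ₚ-assoc [] B C = ≋-refl
  *ₚ-assoc (a ∷ A) B C =
    ≋-trans (*ₚ-distribʳ (scale a B) (0# ∷ (A *ₚ B)) C)
    (+ₚ-cong (scale-*ₚ a B C) (≋-trans (0∷-*ₚ (A *ₚ B) C) (∷-cong refl (*ₚ-assoc A B C))))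

  *ₚ-∷ʳ : ∀ A b B → (A *ₚ (b ∷ B)) ≋ (scale b A +ₚ (0# ∷ (A *ₚ B)))
  *ₚ-∷ʳ [] b B = ≋-sym 0∷[]≋[]
  *ₚ-∷ʳ (a ∷ A) b B =
    ≋-trans (+ₚ-cong (≋-refl {scale a (b ∷ B)}) (∷-cong refl (*ₚ-∷ʳ A b B)))
    (∷-cong (cong (_+ 0#) (*-comm a b)) (+ₚ-left-comm (scale a B) (scale b A) (0# ∷ (A *ₚ B))))

  *ₚ-comm : ∀ A B → (A *ₚ B) ≋ (B *ₚ A)
  *ₚ-comm [] B = ≋-sym (*ₚ-zeroʳ B)
  *ₚ-comm (a ∷ A) B = ≋-trans (+ₚ-cong ≋-refl (∷-cong refl (*ₚ-comm A B))) (≋-sym (*ₚ-∷ʳ B a A))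

  *ₚ-identityˡ : ∀ A → (1ₚ *ₚ A) ≋ A
  *ₚ-identityˡ A = ≋-trans (+ₚ-cong (scale-1# A) 0∷[]≋[]) (+ₚ-identityʳ A)

  *ₚ-identityʳ : ∀ A → (A *ₚ 1ₚ) ≋ A
  *ₚ-identityʳ A = ≋-trans (*ₚ-comm A 1ₚ) (*ₚ-identityˡ A)

  isCommutativeRingₚ : IsCommutativeRing _≋_ _+ₚ_ _*ₚ_ negₚ [] 1ₚ
  isCommutativeRingₚ = record
    { isRing = record
      { +-isAbelianGroup = record
        { isGroup = record
          { isMonoid = record
            { isSemigroup = record
              { isMagma = record { isEquivalence = ≋-isEquivalence ; ∙-cong = +ₚ-cong }
              ; assoc = +ₚ-assoc }
            ; identity = +ₚ-identityˡ , +ₚ-identityʳ }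
          ; inverse = +ₚ-inverseˡ , +ₚ-inverseʳ
          ; ⁻¹-cong = negₚ-cong }
        ; comm = +ₚ-comm }
      ; *-cong = *ₚ-cong
      ; *-assoc = *ₚ-assoc
      ; *-identity = *ₚ-identityˡ , *ₚ-identityʳ
      ; distrib = *ₚ-distribˡ , (λ x y z → *ₚ-distribʳ y z x) }
    ; *-comm = *ₚ-comm }

  commutativeRingₚ : CommutativeRing 0ℓ 0ℓ
  commutativeRingₚ = record { isCommutativeRing = isCommutativeRingₚ }

module PolyDegree (𝔽 : FiniteField) where
  open ≡
  open PolyRing 𝔽

  open FiniteField 𝔽
  open Polynomials 𝔽
  open IsCommutativeRing isCommutativeRing using
    (+-comm; +-assoc; *-comm; *-assoc; +-identityˡ; +-identityʳ; *-identityˡ; *-identityʳ; zeroˡ; zeroʳ)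
  open RingProperties (CommutativeRing.ring field-commutativeRing) using (-‿involutive)

  c*x≡0⇒x≡0 : ∀ {c x} → c ≢ 0# → c * x ≡ 0# → x ≡ 0#
  c*x≡0⇒x≡0 {c} {x} nz p = begin
      x                 ≡⟨ sym (*-identityˡ x) ⟩
      1# * x            ≡⟨ cong (_* x) (trans (sym (inverseʳ c nz)) (*-comm c (c ⁻¹))) ⟩
      (c ⁻¹ * c) * x    ≡⟨ *-assoc _ _ _ ⟩
      c ⁻¹ * (c * x)    ≡⟨ cong (c ⁻¹ *_) p ⟩
      c ⁻¹ * 0#         ≡⟨ zeroʳ _ ⟩
      0# ∎
    where open ≡-Reasoning

  x*y≢0 : ∀ {a b} → a ≢ 0# → b ≢ 0# → a * b ≢ 0#
  x*y≢0 a≢0 b≢0 ab≡0 = b≢0 (c*x≡0⇒x≡0 a≢0 ab≡0)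

  x⁻¹≢0 : ∀ {c} → c ≢ 0# → c ⁻¹ ≢ 0#
  x⁻¹≢0 {c} nz p = 0≢1 (trans (sym (zeroʳ c)) (trans (cong (c *_) (sym p)) (inverseʳ c nz)))

  -x≡0⇒x≡0 : ∀ {x} → - x ≡ 0# → x ≡ 0#
  -x≡0⇒x≡0 {x} p = trans (sym (-‿involutive x)) (trans (cong -_ p) -0#≡0#)

  coeff-consN : ∀ a B i → coeff (consN a B) i ≡ coeff (a ∷ B) i
  coeff-consN a [] i with a ≟ 0#
  coeff-consN a [] zero    | yes p = sym p
  coeff-consN a [] (suc i) | yes p = refl
  coeff-consN a [] i       | no _  = refl
  coeff-consN a (b ∷ B) i = refl

  coeff-strip : ∀ A i → coeff (strip A) i ≡ coeff A i
  coeff-strip []      i       = refl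
  coeff-strip (a ∷ A) zero    = coeff-consN a (strip A) zero
  coeff-strip (a ∷ A) (suc i) = trans (coeff-consN a (strip A) (suc i)) (coeff-strip A i)

  strip≋ : ∀ A → strip A ≋ A
  strip≋ A = ⟨ coeff-strip A ⟩

  Normal : Poly → Set
  Normal [] = ⊤
  Normal (a ∷ []) = a ≢ 0#
  Normal (a ∷ b ∷ B) = Normal (b ∷ B)

  Normal-tail : ∀ a A → Normal (a ∷ A) → Normal A
  Normal-tail a [] _ = tt
  Normal-tail a (b ∷ B) n = n

  Normal-consN : ∀ a B → Normal B → Normal (consN a B)
  Normal-consN a [] _ with a ≟ 0#
  ... | yes _ = tt
  ... | no p = p
  Normal-consN a (b ∷ B) n = n

  Normal-strip : ∀ A → Normal (strip A)
  Normal-strip [] = tt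
  Normal-strip (a ∷ A) = Normal-consN a (strip A) (Normal-strip A)

  Normal⇒≉[] : ∀ a A → Normal (a ∷ A) → (a ∷ A) ≋ [] → ⊥
  Normal⇒≉[] a [] n p = n (proj₁ (∷≋[]⇒ p))
  Normal⇒≉[] a (b ∷ B) n p = Normal⇒≉[] b B n (proj₂ (∷≋[]⇒ p))

  Normal-≋⇒≡ : ∀ A B → Normal A → Normal B → A ≋ B → A ≡ B
  Normal-≋⇒≡ [] [] _ _ _ = refl
  Normal-≋⇒≡ [] (b ∷ B) _ nB p = ⊥-elim (Normal⇒≉[] b B nB (≋-sym p))
  Normal-≋⇒≡ (a ∷ A) [] nA _ p = ⊥-elim (Normal⇒≉[] a A nA p)
  Normal-≋⇒≡ (a ∷ A) (b ∷ B) nA nB p with ∷-injective p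
  ... | e , q = cong₂ _∷_ e (Normal-≋⇒≡ A B (Normal-tail a A nA) (Normal-tail b B nB) q)

  strip-cong : ∀ {A B} → A ≋ B → strip A ≡ strip B
  strip-cong {A} {B} p = Normal-≋⇒≡ _ _ (Normal-strip A) (Normal-strip B) (≋-trans (strip≋ A) (≋-trans p (≋-sym (strip≋ B))))

  len-cong : ∀ {A B} → A ≋ B → len A ≡ len B
  len-cong p = cong length (strip-cong p)

  lc-cong : ∀ {A B} → A ≋ B → lc A ≡ lc B
  lc-cong p = cong lastOr0 (strip-cong p)

  strip-idem : ∀ A → strip (strip A) ≡ strip A
  strip-idem A = strip-cong (strip≋ A)

  len-strip : ∀ A → len (strip A) ≡ len A
  len-strip A = cong length (strip-idem A)

  coeff-≥length : ∀ A i → length A ≤ℕ i → coeff A i ≡ 0#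
  coeff-≥length [] i _ = refl
  coeff-≥length (a ∷ A) (suc i) (s≤s p) = coeff-≥length A i p

  coeff-≥len : ∀ A i → len A ≤ℕ i → coeff A i ≡ 0#
  coeff-≥len A i p = trans (sym (coeff-strip A i)) (coeff-≥length (strip A) i p)

  Normal-last≢0 : ∀ A d → Normal A → length A ≡ suc d → coeff A d ≢ 0#
  Normal-last≢0 (a ∷ []) zero n refl = n
  Normal-last≢0 (a ∷ b ∷ B) (suc d) n eq = Normal-last≢0 (b ∷ B) d n (ℕP.suc-injective eq)

  coeff-deg≢0 : ∀ A d → len A ≡ suc d → coeff A d ≢ 0#
  coeff-deg≢0 A d eq z = Normal-last≢0 (strip A) d (Normal-strip A) eq (trans (coeff-strip A d) z)

  len≤ : ∀ A j → (∀ i → j ≤ℕ i → coeff A i ≡ 0#) → len A ≤ℕ j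
  len≤ A j h with len A in eq
  ... | zero = z≤n
  ... | suc d with suc d ℕ.≤? j
  ...   | yes p = p
  ...   | no np = ⊥-elim (coeff-deg≢0 A d eq (h d (ℕP.≤-pred (ℕP.≰⇒> np))))

  coeff≢0⇒<len : ∀ A d → coeff A d ≢ 0# → d <ℕ len A
  coeff≢0⇒<len A d nz with d ℕ.<? len A
  ... | yes p = p
  ... | no np = ⊥-elim (nz (coeff-≥len A d (ℕP.≮⇒≥ np)))

  len≡suc : ∀ A d → coeff A d ≢ 0# → (∀ i → d <ℕ i → coeff A i ≡ 0#) → len A ≡ suc d
  len≡suc A d nz h = ℕP.≤-antisym (len≤ A (suc d) h) (coeff≢0⇒<len A d nz)

  len-mono : ∀ A B → (∀ i → coeff A i ≡ 0# → coeff B i ≡ 0#) → len B ≤ℕ len A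
  len-mono A B h = len≤ B (len A) (λ i p → h i (coeff-≥len A i p))

  len-≡ : ∀ A B → (∀ i → coeff A i ≡ 0# → coeff B i ≡ 0#) → (∀ i → coeff B i ≡ 0# → coeff A i ≡ 0#) → len A ≡ len B
  len-≡ A B h k = ℕP.≤-antisym (len-mono B A k) (len-mono A B h)

  lastOr0-coeff : ∀ L → lastOr0 L ≡ coeff L (length L ∸ 1)
  lastOr0-coeff [] = refl
  lastOr0-coeff (a ∷ []) = refl
  lastOr0-coeff (a ∷ b ∷ B) = lastOr0-coeff (b ∷ B)

  lc-coeff : ∀ A → lc A ≡ coeff A (len A ∸ 1)
  lc-coeff A = trans (lastOr0-coeff (strip A)) (coeff-strip A _)

  lc≢0 : ∀ A d → len A ≡ suc d → lc A ≢ 0#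
  lc≢0 A d eq z = coeff-deg≢0 A d eq (trans (subst (λ k → coeff A (k ∸ 1) ≡ lc A) eq (sym (lc-coeff A))) z)

  lc≡coeff-deg : ∀ A d → len A ≡ suc d → lc A ≡ coeff A d
  lc≡coeff-deg A d eq = trans (lc-coeff A) (cong (λ k → coeff A (k ∸ 1)) eq)

  len≡0⇒≋[] : ∀ A → len A ≡ 0 → A ≋ []
  len≡0⇒≋[] A p = ⟨ (λ i → coeff-≥len A i (subst (_≤ℕ i) (sym p) z≤n)) ⟩

  ≋[]⇒len≡0 : ∀ {A} → A ≋ [] → len A ≡ 0
  ≋[]⇒len≡0 p = len-cong p

  ≋[]? : ∀ A → Dec (A ≋ [])
  ≋[]? A with len A ℕ.≟ 0
  ... | yes p = yes (len≡0⇒≋[] A p)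
  ... | no np = no (λ z → np (≋[]⇒len≡0 z))

  ≉[]⇒len≡suc : ∀ A → ¬ (A ≋ []) → ∃ λ d → len A ≡ suc d
  ≉[]⇒len≡suc A nz with len A in eq
  ... | zero = ⊥-elim (nz (len≡0⇒≋[] A eq))
  ... | suc d = d , refl

  len≡suc⇒≉[] : ∀ A {d} → len A ≡ suc d → ¬ (A ≋ [])
  len≡suc⇒≉[] A eA A≋0 = ℕP.1+n≢0 (trans (sym eA) (≋[]⇒len≡0 A≋0))

  len-cons : ∀ a A d → len A ≡ suc d → len (a ∷ A) ≡ suc (suc d)
  len-cons a A d eq = len≡suc (a ∷ A) (suc d) (coeff-deg≢0 A d eq) h
    where
    h : ∀ i → suc d <ℕ i → coeff (a ∷ A) i ≡ 0#
    h (suc i) (s≤s p) = coeff-≥len A i (subst (_≤ℕ i) (sym eq) p)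

  len-+ₚ≤ : ∀ A B j → len A ≤ℕ j → len B ≤ℕ j → len (A +ₚ B) ≤ℕ j
  len-+ₚ≤ A B j p q = len≤ (A +ₚ B) j (λ i r → trans (coeff-+ₚ A B i)
    (trans (cong₂ _+_ (coeff-≥len A i (ℕP.≤-trans p r)) (coeff-≥len B i (ℕP.≤-trans q r))) (+-identityˡ 0#)))

  len-negₚ : ∀ A → len (negₚ A) ≡ len A
  len-negₚ A = len-≡ (negₚ A) A (λ i p → -x≡0⇒x≡0 (trans (sym (coeff-negₚ A i)) p)) (λ i p → trans (coeff-negₚ A i) (trans (cong -_ p) -0#≡0#))

  len-scale≤ : ∀ c A → len (scale c A) ≤ℕ len A
  len-scale≤ c A = len-mono A (scale c A) (λ i p → trans (coeff-scale c A i) (trans (cong (c *_) p) (zeroʳ c)))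

  len-scale : ∀ c A → c ≢ 0# → len (scale c A) ≡ len A
  len-scale c A nz = ℕP.≤-antisym (len-scale≤ c A) (len-mono (scale c A) A (λ i p → c*x≡0⇒x≡0 nz (trans (sym (coeff-scale c A i)) p)))

  coeff-*ₚ-top : ∀ A B dA dB → (∀ i → dA <ℕ i → coeff A i ≡ 0#) → (∀ i → dB <ℕ i → coeff B i ≡ 0#) →
                 coeff (A *ₚ B) (dA +ℕ dB) ≡ coeff A dA * coeff B dB × (∀ i → dA +ℕ dB <ℕ i → coeff (A *ₚ B) i ≡ 0#)
  coeff-*ₚ-top []      B dA       dB hA hB = sym (zeroˡ _) , (λ i _ → refl)
  coeff-*ₚ-top (a ∷ A) B zero     dB hA hB = top , beyond
    where
    aA*B≋aB : (a ∷ A) *ₚ B ≋ scale a B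
    aA*B≋aB = ≋-trans (+ₚ-cong ≋-refl (≋-trans (∷-cong refl (*ₚ-zeroˡ A B ⟨ (λ i → hA (suc i) (s≤s z≤n)) ⟩)) 0∷[]≋[])) (+ₚ-identityʳ _)
    top = trans (coeff-≡ aA*B≋aB dB) (coeff-scale a B dB)
    beyond : ∀ i → dB <ℕ i → coeff ((a ∷ A) *ₚ B) i ≡ 0#
    beyond i p = trans (coeff-≡ aA*B≋aB i) (trans (coeff-scale a B i) (trans (cong (a *_) (hB i p)) (zeroʳ a)))
  coeff-*ₚ-top (a ∷ A) B (suc dA) dB hA hB = top , beyond
    where
    IH = coeff-*ₚ-top A B dA dB (λ i p → hA (suc i) (s≤s p)) hB
    aB-above : ∀ j → dB <ℕ j → coeff (scale a B) j ≡ 0#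
    aB-above j p = trans (coeff-scale a B j) (trans (cong (a *_) (hB j p)) (zeroʳ a))
    top : coeff ((a ∷ A) *ₚ B) (suc (dA +ℕ dB)) ≡ coeff A dA * coeff B dB
    top = trans (coeff-+ₚ (scale a B) (0# ∷ (A *ₚ B)) (suc (dA +ℕ dB)))
                (trans (cong₂ _+_ (aB-above _ (s≤s (ℕP.m≤n+m dB dA))) (proj₁ IH)) (+-identityˡ _))
    beyond : ∀ i → suc (dA +ℕ dB) <ℕ i → coeff ((a ∷ A) *ₚ B) i ≡ 0#
    beyond (suc i) (s≤s p) = trans (coeff-+ₚ (scale a B) (0# ∷ (A *ₚ B)) (suc i))
      (trans (cong₂ _+_ (aB-above _ (ℕP.≤-trans (s≤s (ℕP.m≤n+m dB dA)) (ℕP.<⇒≤ (s≤s p)))) (proj₂ IH i p)) (+-identityˡ _))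

  coeff->deg : ∀ A d → len A ≡ suc d → ∀ i → d <ℕ i → coeff A i ≡ 0#
  coeff->deg A d eq i p = coeff-≥len A i (subst (_≤ℕ i) (sym eq) p)

  len-*ₚ : ∀ A B dA dB → len A ≡ suc dA → len B ≡ suc dB → len (A *ₚ B) ≡ suc (dA +ℕ dB)
  len-*ₚ A B dA dB eA eB = len≡suc (A *ₚ B) (dA +ℕ dB) top≢0 (proj₂ top)
    where
    top = coeff-*ₚ-top A B dA dB (coeff->deg A dA eA) (coeff->deg B dB eB)
    top≢0 : coeff (A *ₚ B) (dA +ℕ dB) ≢ 0#
    top≢0 z = x*y≢0 (coeff-deg≢0 A dA eA) (coeff-deg≢0 B dB eB) (trans (sym (proj₁ top)) z)

  lc-*ₚ : ∀ A B dA dB → len A ≡ suc dA → len B ≡ suc dB → lc (A *ₚ B) ≡ lc A * lc B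
  lc-*ₚ A B dA dB eA eB = trans (lc≡coeff-deg (A *ₚ B) _ (len-*ₚ A B dA dB eA eB))
    (trans (proj₁ (coeff-*ₚ-top A B dA dB (coeff->deg A dA eA) (coeff->deg B dB eB))) (sym (cong₂ _*_ (lc≡coeff-deg A dA eA) (lc≡coeff-deg B dB eB))))

  *ₚ-≉[] : ∀ A B → ¬ (A ≋ []) → ¬ (B ≋ []) → ¬ ((A *ₚ B) ≋ [])
  *ₚ-≉[] A B A≉0 B≉0 with ≉[]⇒len≡suc A A≉0 | ≉[]⇒len≡suc B B≉0
  ... | dA , eA | dB , eB = len≡suc⇒≉[] (A *ₚ B) (len-*ₚ A B dA dB eA eB)

  *ₚ≋[]⇒ : ∀ A B → (A *ₚ B) ≋ [] → A ≋ [] ⊎ B ≋ []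
  *ₚ≋[]⇒ A B z with ≋[]? A | ≋[]? B
  ... | yes p | _ = inj₁ p
  ... | no _ | yes q = inj₂ q
  ... | no p | no q = ⊥-elim (*ₚ-≉[] A B p q z)

  len-≤*ₚ : ∀ A B → ¬ (A ≋ []) → len B ≤ℕ len (A *ₚ B)
  len-≤*ₚ A B nA with ≋[]? B
  ... | yes z = subst (_≤ℕ len (A *ₚ B)) (sym (≋[]⇒len≡0 z)) z≤n
  ... | no nB with ≉[]⇒len≡suc A nA | ≉[]⇒len≡suc B nB
  ... | dA , eA | dB , eB = subst₂ _≤ℕ_ (sym eB) (sym (len-*ₚ A B dA dB eA eB)) (s≤s (ℕP.m≤n+m dB dA))

  const : Carrier → Poly
  const c = c ∷ []

  1ₚ≉[] : ¬ (1ₚ ≋ [])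
  1ₚ≉[] z = 0≢1 (sym (coeff-≡ z 0))

  len-1ₚ : len 1ₚ ≡ 1
  len-1ₚ = len≡suc 1ₚ 0 (λ z → 0≢1 (sym z)) (λ { (suc i) _ → refl })

  len≤1⇒≋const : ∀ A → len A ≤ℕ 1 → A ≋ const (coeff A 0)
  len≤1⇒≋const A p = ⟨ f ⟩
    where
    f : ∀ i → coeff A i ≡ coeff (const (coeff A 0)) i
    f zero = refl
    f (suc i) = coeff-≥len A (suc i) (ℕP.≤-trans p (s≤s z≤n))

  len-const : ∀ c → c ≢ 0# → len (const c) ≡ 1
  len-const c nz = len≡suc (const c) 0 nz (λ { (suc i) _ → refl })

  const-*ₚ : ∀ c A → (const c *ₚ A) ≋ scale c A
  const-*ₚ c A = ≋-trans (+ₚ-cong ≋-refl 0∷[]≋[]) (+ₚ-identityʳ _)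

  Unit⇒len≡1 : ∀ U → Unit U → len U ≡ 1
  Unit⇒len≡1 U (V , UV≈1) with ≋[]? U | ≋[]? V
  ... | yes U≋0 | _ = ⊥-elim (1ₚ≉[] (≋-trans (≋-sym ⟨ UV≈1 ⟩) (*ₚ-zeroˡ U V U≋0)))
  ... | no _ | yes V≋0 = ⊥-elim (1ₚ≉[] (≋-trans (≋-sym ⟨ UV≈1 ⟩) (≋-trans (*ₚ-comm U V) (*ₚ-zeroˡ V U V≋0))))
  ... | no U≉0 | no V≉0 with ≉[]⇒len≡suc U U≉0 | ≉[]⇒len≡suc V V≉0
  ... | dU , eU | dV , eV = trans eU (cong suc (ℕP.m+n≡0⇒m≡0 dU dU+dV≡0))
    where
    dU+dV≡0 : dU +ℕ dV ≡ 0
    dU+dV≡0 = ℕP.suc-injective (trans (sym (len-*ₚ U V dU dV eU eV)) (trans (len-cong {U *ₚ V} {1ₚ} ⟨ UV≈1 ⟩) len-1ₚ))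

  len≡1⇒Unit : ∀ U → len U ≡ 1 → Unit U
  len≡1⇒Unit U eq = const (c ⁻¹) , coeff-≡ e
    where
    c = coeff U 0
    nz : c ≢ 0#
    nz = coeff-deg≢0 U 0 eq
    e : (U *ₚ const (c ⁻¹)) ≋ 1ₚ
    e = ≋-trans (*ₚ-comm U _) (≋-trans (const-*ₚ _ U) (≋-trans (scale-congʳ (len≤1⇒≋const U (ℕP.≤-reflexive eq)))
        (∷-cong (trans (*-comm _ _) (inverseʳ c nz)) ≋-refl)))

  Unit? : ∀ U → Dec (Unit U)
  Unit? U with len U ℕ.≟ 1
  ... | yes p = yes (len≡1⇒Unit U p)
  ... | no np = no (λ u → np (Unit⇒len≡1 U u))

module PolyDivision (𝔽 : FiniteField) where
  open ≡
  open PolyRing 𝔽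
  open PolyDegree 𝔽
  open IntegerSolver commutativeRingₚ using (solve; _:+_; _:*_; :-_; _:=_; _:-_)

  open FiniteField 𝔽
  open Polynomials 𝔽
  open IsCommutativeRing isCommutativeRing using
    (+-comm; +-assoc; *-comm; *-assoc; +-identityˡ; +-identityʳ; *-identityˡ; *-identityʳ; zeroˡ; zeroʳ; -‿inverseʳ)

  infix 4 _∣_ _∣?_ _≋?_

  coeff-shift : ∀ k A i → coeff (shift k A) (k +ℕ i) ≡ coeff A i
  coeff-shift zero    A i = refl
  coeff-shift (suc k) A i = coeff-shift k A i

  shift-cong : ∀ k {X Y} → X ≋ Y → shift k X ≋ shift k Y
  shift-cong zero p = p
  shift-cong (suc k) p = ∷-cong refl (shift-cong k p)

  shift-*ₚ : ∀ k X Y → (shift k X *ₚ Y) ≋ shift k (X *ₚ Y)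
  shift-*ₚ zero X Y = ≋-refl
  shift-*ₚ (suc k) X Y = ≋-trans (0∷-*ₚ (shift k X) Y) (∷-cong refl (shift-*ₚ k X Y))

  coeff-shift≥ : ∀ k X i → k ≤ℕ i → coeff (shift k X) i ≡ coeff X (i ∸ k)
  coeff-shift≥ k X i p = trans (cong (coeff (shift k X)) (sym (ℕP.m+[n∸m]≡n p))) (coeff-shift k X (i ∸ k))

  len-shift : ∀ i X d → len X ≡ suc d → len (shift i X) ≡ suc (i +ℕ d)
  len-shift zero    X d eX = eX
  len-shift (suc i) X d eX = len-cons 0# (shift i X) (i +ℕ d) (len-shift i X d eX)

  *ₚ-shift-1ₚ : ∀ i X → X *ₚ shift i 1ₚ ≋ shift i X
  *ₚ-shift-1ₚ i X = ≋-trans (*ₚ-comm X (shift i 1ₚ)) (≋-trans (shift-*ₚ i 1ₚ X) (shift-cong i (*ₚ-identityˡ X)))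

  length-strip≤ : ∀ A → length (strip A) ≤ℕ length A
  length-strip≤ [] = z≤n
  length-strip≤ (a ∷ A) = length-consN≤ (strip A) (length-strip≤ A)
    where
    length-consN≤ : ∀ B → length B ≤ℕ length A → length (consN a B) ≤ℕ suc (length A)
    length-consN≤ [] _ with a ≟ 0#
    ... | yes _ = z≤n
    ... | no _ = s≤s z≤n
    length-consN≤ (b ∷ B) p = s≤s p

  len-+ₚ< : ∀ X Y n → len X <ℕ n → len Y <ℕ n → len (X +ₚ Y) <ℕ n
  len-+ₚ< X Y (suc n) p q = s≤s (len-+ₚ≤ X Y n (ℕP.≤-pred p) (ℕP.≤-pred q))

  len--ₚ< : ∀ X Y n → len X <ℕ n → len Y <ℕ n → len (X -ₚ Y) <ℕ n
  len--ₚ< X Y n p q = len-+ₚ< X (negₚ Y) n p (subst (_<ℕ n) (sym (len-negₚ Y)) q)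

  -- One step of long division: subtract c·xᵏ·M, where c·xᵏ is the quotient of the leading terms.
  module DivisionStep (A M : Poly) (dM d : ℕ) (eM : len M ≡ suc dM) (eA : len A ≡ suc d) (dM≤d : dM ≤ℕ d) where
    k = len A ∸ len M
    c = lc A * lc M ⁻¹
    A′ = strip A -ₚ shift k (scale c M)

    k+dM≡d : k +ℕ dM ≡ d
    k+dM≡d = trans (cong (_+ℕ dM) (cong₂ _∸_ eA eM)) (ℕP.m∸n+n≡m dM≤d)

    k≤d : k ≤ℕ d
    k≤d = subst (k ≤ℕ_) k+dM≡d (ℕP.m≤m+n k dM)

    d∸k≡dM : d ∸ k ≡ dM
    d∸k≡dM = trans (cong (_∸ k) (sym k+dM≡d)) (ℕP.m+n∸m≡n k dM)

    A≋A′+cxᵏM : A ≋ A′ +ₚ shift k (const c) *ₚ M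
    A≋A′+cxᵏM = ≋-sym (≋-trans (+ₚ-cong ≋-refl (≋-trans (shift-*ₚ k (const c) M) (shift-cong k (const-*ₚ c M))))
                 (≋-trans (solve 2 (λ x y → (x :- y) :+ y := x) ≋-refl (strip A) (shift k (scale c M))) (strip≋ A)))

    c*lcM≡lcA : c * lc M ≡ lc A
    c*lcM≡lcA = trans (*-assoc _ _ _) (trans (cong (lc A *_) (trans (*-comm _ _) (inverseʳ (lc M) (lc≢0 M dM eM)))) (*-identityʳ _))

    coeff-A′ : ∀ i → k ≤ℕ i → coeff A′ i ≡ coeff A i + - (c * coeff M (i ∸ k))
    coeff-A′ i k≤i = trans (coeff-+ₚ (strip A) (negₚ (shift k (scale c M))) i) (cong₂ _+_ (coeff-strip A i)
      (trans (coeff-negₚ (shift k (scale c M)) i) (cong -_ (trans (coeff-shift≥ k (scale c M) i k≤i) (coeff-scale c M (i ∸ k))))))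

    coeff-A′-≥d : ∀ i → d ≤ℕ i → coeff A′ i ≡ 0#
    coeff-A′-≥d i d≤i with ℕP.m≤n⇒m<n∨m≡n d≤i
    ... | inj₁ d<i = begin
      coeff A′ i                          ≡⟨ coeff-A′ i (ℕP.≤-trans k≤d d≤i) ⟩
      coeff A i + - (c * coeff M (i ∸ k)) ≡⟨ cong₂ (λ u v → u + - (c * v)) (coeff->deg A d eA i d<i) (coeff->deg M dM eM (i ∸ k) dM<i∸k) ⟩
      0# + - (c * 0#)                     ≡⟨ cong (λ z → 0# + - z) (zeroʳ c) ⟩
      0# + - 0#                           ≡⟨ +-identityˡ _ ⟩
      - 0#                                ≡⟨ -0#≡0# ⟩
      0#                                  ∎
      where
      open ≡-Reasoning
      dM<i∸k : dM <ℕ i ∸ k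
      dM<i∸k = subst (_≤ℕ i ∸ k) (trans (ℕP.+-∸-assoc 1 k≤d) (cong suc d∸k≡dM)) (ℕP.∸-monoˡ-≤ k d<i)
    ... | inj₂ refl = begin
      coeff A′ d                          ≡⟨ coeff-A′ d k≤d ⟩
      coeff A d + - (c * coeff M (d ∸ k)) ≡⟨ cong₂ (λ u v → u + - (c * coeff M v)) (sym (lc≡coeff-deg A d eA)) d∸k≡dM ⟩
      lc A + - (c * coeff M dM)           ≡⟨ cong (λ v → lc A + - (c * v)) (sym (lc≡coeff-deg M dM eM)) ⟩
      lc A + - (c * lc M)                 ≡⟨ cong (λ v → lc A + - v) c*lcM≡lcA ⟩
      lc A + - lc A                       ≡⟨ -‿inverseʳ (lc A) ⟩
      0#                                  ∎
      where open ≡-Reasoning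

    len-A′<len-A : len A′ <ℕ len A
    len-A′<len-A = subst (len A′ <ℕ_) (sym eA) (s≤s (len≤ A′ d coeff-A′-≥d))

  remAux-spec : ∀ f A M dM → len M ≡ suc dM → len A <ℕ f +ℕ len M →
                Σ Poly (λ Q → A ≋ Q *ₚ M +ₚ remAux f A M) × len (remAux f A M) <ℕ len M
  remAux-spec zero A M dM eM lt = ([] , ≋-sym (strip≋ A)) , subst (_<ℕ len M) (sym (len-strip A)) lt
  remAux-spec (suc f) A M dM eM lt with len A <ᵇ len M in eq
  ... | true  = ([] , ≋-sym (strip≋ A)) , subst (_<ℕ len M) (sym (len-strip A)) (ℕP.<ᵇ⇒< (len A) (len M) (subst T (sym eq) tt))
  ... | false = (Q′ +ₚ shift k (const c) , A≋QM+R) , proj₂ recursion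
    where
    M≤A : len M ≤ℕ len A
    M≤A = ℕP.≮⇒≥ (λ A<M → subst T eq (ℕP.<⇒<ᵇ A<M))
    A≉0 : ¬ (A ≋ [])
    A≉0 A≋0 = ℕP.n≮0 (subst (suc dM ≤ℕ_) (≋[]⇒len≡0 A≋0) (subst (_≤ℕ len A) eM M≤A))
    d = proj₁ (≉[]⇒len≡suc A A≉0)
    eA = proj₂ (≉[]⇒len≡suc A A≉0)
    open DivisionStep A M dM d eM eA (ℕP.≤-pred (subst₂ _≤ℕ_ eM eA M≤A))
    recursion = remAux-spec f A′ M dM eM (ℕP.<-≤-trans len-A′<len-A (ℕP.≤-pred lt))
    Q′ = proj₁ (proj₁ recursion)
    A≋QM+R : A ≋ (Q′ +ₚ shift k (const c)) *ₚ M +ₚ remAux f A′ M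
    A≋QM+R = ≋-trans A≋A′+cxᵏM (≋-trans (+ₚ-cong (proj₂ (proj₁ recursion)) ≋-refl)
               (solve 4 (λ q s m r → ((q :* m) :+ r) :+ (s :* m) := ((q :+ s) :* m) :+ r) ≋-refl Q′ (shift k (const c)) M (remAux f A′ M)))

  rem-spec : ∀ A M → ¬ (M ≋ []) → Σ Poly (λ Q → A ≋ Q *ₚ M +ₚ rem A M) × len (rem A M) <ℕ len M
  rem-spec A M M≉0 = (Q , ≋-trans A≋ (+ₚ-cong (*ₚ-congʳ Q (strip≋ M)) ≋-refl)) , subst (len (rem A M) <ℕ_) (len-strip M) (proj₂ spec)
    where
    dM = proj₁ (≉[]⇒len≡suc M M≉0)
    eM = proj₂ (≉[]⇒len≡suc M M≉0)
    len-A<fuel : len A <ℕ length A +ℕ len (strip M)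
    len-A<fuel = subst (λ z → len A <ℕ length A +ℕ z) (sym (trans (len-strip M) eM))
                   (ℕP.≤-trans (s≤s (length-strip≤ A)) (subst (suc (length A) ≤ℕ_) (sym (ℕP.+-suc (length A) dM)) (s≤s (ℕP.m≤m+n (length A) dM))))
    spec = remAux-spec (length A) A (strip M) dM (trans (len-strip M) eM) len-A<fuel
    Q = proj₁ (proj₁ spec)
    A≋ = proj₂ (proj₁ spec)

  -ₚ≋[]⇒≋ : ∀ {A B} → A -ₚ B ≋ [] → A ≋ B
  -ₚ≋[]⇒≋ {A} {B} A-B≋0 = ≋-trans (solve 2 (λ a b → a := (a :- b) :+ b) ≋-refl A B) (+ₚ-cong A-B≋0 ≋-refl)

  remainder-unique : ∀ Q Q′ M R R′ → Q *ₚ M +ₚ R ≋ Q′ *ₚ M +ₚ R′ → len R <ℕ len M → len R′ <ℕ len M → R ≋ R′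
  remainder-unique Q Q′ M R R′ h lR lR′ = ≋-sym (-ₚ≋[]⇒≋ R′-R≋0)
    where
    [Q-Q′]M≋R′-R : (Q -ₚ Q′) *ₚ M ≋ R′ -ₚ R
    [Q-Q′]M≋R′-R = ≋-trans (solve 4 (λ q q′ m r → (q :- q′) :* m := ((q :* m :+ r) :- q′ :* m) :- r) ≋-refl Q Q′ M R)
                  (≋-trans (+ₚ-cong (+ₚ-cong h ≋-refl) ≋-refl)
                           (solve 4 (λ q′ m r r′ → ((q′ :* m :+ r′) :- q′ :* m) :- r := r′ :- r) ≋-refl Q′ M R R′))
    R′-R≋0 : R′ -ₚ R ≋ []
    R′-R≋0 with ≋[]? (Q -ₚ Q′)
    ... | yes Q-Q′≋0 = ≋-trans (≋-sym [Q-Q′]M≋R′-R) (*ₚ-zeroˡ _ M Q-Q′≋0)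
    ... | no Q-Q′≉0  = ⊥-elim (ℕP.<-irrefl refl (ℕP.≤-trans (len--ₚ< R′ R (len M) lR′ lR)
                                              (ℕP.≤-trans (len-≤*ₚ (Q -ₚ Q′) M Q-Q′≉0) (ℕP.≤-reflexive (len-cong [Q-Q′]M≋R′-R)))))

  _∣_ : Poly → Poly → Set
  B ∣ A = Σ Poly λ Q → A ≋ (Q *ₚ B)

  ∣ₚ⇒∣ : ∀ {B A} → B ∣ₚ A → B ∣ A
  ∣ₚ⇒∣ (Q , p) = Q , ⟨ p ⟩

  ∣⇒∣ₚ : ∀ {B A} → B ∣ A → B ∣ₚ A
  ∣⇒∣ₚ (Q , p) = Q , coeff-≡ p

  Unit⇒inverse : ∀ {U} → Unit U → Σ Poly λ V → (U *ₚ V) ≋ 1ₚ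
  Unit⇒inverse (V , p) = V , ⟨ p ⟩

  inverse⇒Unit : ∀ {U} → (Σ Poly λ V → (U *ₚ V) ≋ 1ₚ) → Unit U
  inverse⇒Unit (V , p) = V , coeff-≡ p

  ∣-refl : ∀ A → A ∣ A
  ∣-refl A = 1ₚ , ≋-sym (*ₚ-identityˡ A)

  ∣-trans : ∀ {A B C} → A ∣ B → B ∣ C → A ∣ C
  ∣-trans {A} {B} {C} (Q , p) (Q' , q) = (Q' *ₚ Q) , ≋-trans q (≋-trans (*ₚ-congʳ Q' p) (≋-sym (*ₚ-assoc Q' Q A)))

  ∣B⇒∣A*B : ∀ {A B} X → A ∣ B → A ∣ (X *ₚ B)
  ∣B⇒∣A*B {A} {B} X (Q , p) = (X *ₚ Q) , ≋-trans (*ₚ-congʳ X p) (≋-sym (*ₚ-assoc X Q A))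

  ∣A⇒∣A*B : ∀ {A B} X → A ∣ B → A ∣ (B *ₚ X)
  ∣A⇒∣A*B {A} {B} X (Q , p) = X *ₚ Q , ≋-trans (*ₚ-comm B X) (≋-trans (*ₚ-congʳ X p) (≋-sym (*ₚ-assoc X Q A)))

  A∣B*A : ∀ A X → A ∣ (X *ₚ A)
  A∣B*A A X = X , ≋-refl

  A∣A*B : ∀ A X → A ∣ (A *ₚ X)
  A∣A*B A X = X , *ₚ-comm A X

  ∣-congʳ : ∀ {A X Y} → X ≋ Y → A ∣ X → A ∣ Y
  ∣-congʳ p (Q , q) = Q , ≋-trans (≋-sym p) q

  ∣-congˡ : ∀ {A A' X} → A ≋ A' → A ∣ X → A' ∣ X
  ∣-congˡ {A} {A'} {X} p (Q , q) = Q , ≋-trans q (*ₚ-congʳ Q p)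

  ∣-+ₚ : ∀ {A X Y} → A ∣ X → A ∣ Y → A ∣ (X +ₚ Y)
  ∣-+ₚ {A} (Q , p) (Q' , q) = (Q +ₚ Q') , ≋-trans (+ₚ-cong p q) (≋-sym (*ₚ-distribʳ Q Q' A))

  ∣-negₚ : ∀ {A X} → A ∣ X → A ∣ (negₚ X)
  ∣-negₚ {A} {X} (Q , p) = negₚ Q , ≋-trans (negₚ-cong p) (solve 2 (λ q a → (:- (q :* a)) := ((:- q) :* a)) ≋-refl Q A)

  ∣--ₚ : ∀ {A X Y} → A ∣ X → A ∣ Y → A ∣ (X -ₚ Y)
  ∣--ₚ p q = ∣-+ₚ p (∣-negₚ q)

  ∣-≋[] : ∀ A X → X ≋ [] → A ∣ X
  ∣-≋[] A X z = [] , z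

  ∣1ₚ⇒Unit : ∀ {C} → C ∣ 1ₚ → Unit C
  ∣1ₚ⇒Unit {C} (Q , p) = inverse⇒Unit {C} (Q , ≋-trans (*ₚ-comm C Q) (≋-sym p))

  1ₚ∣ : ∀ X → 1ₚ ∣ X
  1ₚ∣ X = X , ≋-sym (*ₚ-identityʳ X)

  rem-unique : ∀ A M Q R → ¬ (M ≋ []) → A ≋ ((Q *ₚ M) +ₚ R) → len R <ℕ len M → rem A M ≋ R
  rem-unique A M Q R nz e l with rem-spec A M nz
  ... | (Q' , e') , l' = remainder-unique Q' Q M (rem A M) R (≋-trans (≋-sym e') e) l' l

  rem-cong : ∀ {A B} M → ¬ (M ≋ []) → A ≋ B → rem A M ≋ rem B M
  rem-cong {A} {B} M nz p with rem-spec B M nz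
  ... | (Q , e) , l = rem-unique A M Q (rem B M) nz (≋-trans p e) l

  rem-+ₚ : ∀ A B M → ¬ (M ≋ []) → rem (A +ₚ B) M ≋ (rem A M +ₚ rem B M)
  rem-+ₚ A B M nz with rem-spec A M nz | rem-spec B M nz
  ... | (Q , e) , l | (Q' , e') , l' = rem-unique (A +ₚ B) M (Q +ₚ Q') _ nz
        (≋-trans (+ₚ-cong e e') (solve 5 (λ q q' m r r' → ((q :* m) :+ r) :+ ((q' :* m) :+ r') := ((q :+ q') :* m) :+ (r :+ r'))
                                          ≋-refl Q Q' M (rem A M) (rem B M)))
        (len-+ₚ< (rem A M) (rem B M) (len M) l l')

  rem-scale : ∀ c A M → ¬ (M ≋ []) → rem (scale c A) M ≋ scale c (rem A M)
  rem-scale c A M nz with rem-spec A M nz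
  ... | (Q , e) , l = rem-unique (scale c A) M (scale c Q) _ nz
        (≋-trans (scale-congʳ e) (≋-trans (scale-distribˡ c (Q *ₚ M) (rem A M)) (+ₚ-cong (≋-sym (scale-*ₚ c Q M)) ≋-refl)))
        (ℕP.≤-<-trans (len-scale≤ c (rem A M)) l)

  rem-small : ∀ A M → ¬ (M ≋ []) → len A <ℕ len M → rem A M ≋ A
  rem-small A M nz l = rem-unique A M [] A nz ≋-refl l

  ∣⇒rem≋[] : ∀ A M → ¬ (M ≋ []) → M ∣ A → rem A M ≋ []
  ∣⇒rem≋[] A M nz (Q , e) = rem-unique A M Q [] nz (≋-trans e (≋-sym (+ₚ-identityʳ _)))
                              (ℕP.≤-trans (s≤s z≤n) (ℕP.≤-reflexive (sym (proj₂ (≉[]⇒len≡suc M nz)))))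

  rem≋[]⇒∣ : ∀ A M → ¬ (M ≋ []) → rem A M ≋ [] → M ∣ A
  rem≋[]⇒∣ A M nz z with rem-spec A M nz
  ... | (Q , e) , _ = Q , ≋-trans e (≋-trans (+ₚ-cong ≋-refl z) (+ₚ-identityʳ _))

  _∣?_ : ∀ M A → Dec (M ∣ A)
  M ∣? A with ≋[]? M
  ... | yes zM with ≋[]? A
  ...   | yes zA = yes (∣-≋[] M A zA)
  ...   | no nA = no (λ { (Q , e) → nA (≋-trans e (≋-trans (*ₚ-congʳ Q zM) (*ₚ-zeroʳ Q))) })
  M ∣? A | no nM with ≋[]? (rem A M)
  ...   | yes z = yes (rem≋[]⇒∣ A M nM z)
  ...   | no nz = no (λ d → nz (∣⇒rem≋[] A M nM d))

  rem-cong-mod : ∀ A B M → ¬ (M ≋ []) → M ∣ (A -ₚ B) → rem A M ≋ rem B M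
  rem-cong-mod A B M nz (Q , e) with rem-spec B M nz
  ... | (Q' , e') , l = rem-unique A M (Q +ₚ Q') (rem B M) nz
        (≋-trans (solve 2 (λ a b → a := ((a :+ (:- b)) :+ b)) ≋-refl A B)
         (≋-trans (+ₚ-cong e e') (solve 4 (λ q q' m r → ((q :* m) :+ ((q' :* m) :+ r)) := (((q :+ q') :* m) :+ r)) ≋-refl Q Q' M (rem B M))))
        l

  ∣-rem : ∀ D X M → ¬ (M ≋ []) → D ∣ M → D ∣ X → D ∣ (rem X M)
  ∣-rem D X M nz dM dX with rem-spec X M nz
  ... | (Q , e) , _ = ∣-congʳ (≋-trans (+ₚ-cong e ≋-refl) (solve 2 (λ a r → ((a :+ r) :+ (:- a)) := r) ≋-refl (Q *ₚ M) (rem X M)))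
                       (∣--ₚ dX (∣B⇒∣A*B Q dM))

  t≡coeff : ∀ M A d → len M ≡ suc (suc d) → t M A ≡ coeff (rem A M) d
  t≡coeff M A d p with len M | p
  ... | .(suc (suc d)) | refl = refl

  t-rem : ∀ M A B → rem A M ≋ rem B M → t M A ≡ t M B
  t-rem M A B p with len M
  ... | zero = refl
  ... | suc zero = refl
  ... | suc (suc d) = coeff-≡ p d

  t-cong : ∀ M {A B} → ¬ (M ≋ []) → A ≋ B → t M A ≡ t M B
  t-cong M {A} {B} nz p = t-rem M A B (rem-cong M nz p)

  t-cong-mod : ∀ M A B → ¬ (M ≋ []) → M ∣ (A -ₚ B) → t M A ≡ t M B
  t-cong-mod M A B nz d = t-rem M A B (rem-cong-mod A B M nz d)

  t-+ₚ : ∀ M A B → ¬ (M ≋ []) → t M (A +ₚ B) ≡ t M A + t M B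
  t-+ₚ M A B nz with len M
  ... | zero = sym (+-identityˡ 0#)
  ... | suc zero = sym (+-identityˡ 0#)
  ... | suc (suc d) = trans (coeff-≡ (rem-+ₚ A B M nz) d) (coeff-+ₚ (rem A M) (rem B M) d)

  t-scale : ∀ M c A → ¬ (M ≋ []) → t M (scale c A) ≡ c * t M A
  t-scale M c A nz with len M
  ... | zero = sym (zeroʳ c)
  ... | suc zero = sym (zeroʳ c)
  ... | suc (suc d) = trans (coeff-≡ (rem-scale c A M nz) d) (coeff-scale c (rem A M) d)

  t-∣ : ∀ M A → ¬ (M ≋ []) → M ∣ A → t M A ≡ 0#
  t-∣ M A nz d with len M
  ... | zero = refl
  ... | suc zero = refl
  ... | suc (suc k) = coeff-≡ (∣⇒rem≋[] A M nz d) k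

  _≋?_ : ∀ A B → Dec (A ≋ B)
  A ≋? B with ≋[]? (A -ₚ B)
  ... | yes A-B≋0 = yes (-ₚ≋[]⇒≋ A-B≋0)
  ... | no  A-B≉0 = no (λ A≋B → A-B≉0 (≋-trans (+ₚ-cong A≋B ≋-refl) (+ₚ-inverseʳ B)))

  *ₚ-cancelˡ : ∀ D {B B′} → ¬ (D ≋ []) → D *ₚ B ≋ D *ₚ B′ → B ≋ B′
  *ₚ-cancelˡ D {B} {B′} D≉0 DB≋DB′ = [ (λ D≋0 → ⊥-elim (D≉0 D≋0)) , -ₚ≋[]⇒≋ ]′ (*ₚ≋[]⇒ D (B -ₚ B′) D[B-B′]≋0)
    where
    D[B-B′]≋0 : D *ₚ (B -ₚ B′) ≋ []
    D[B-B′]≋0 = ≋-trans (solve 3 (λ d b b′ → d :* (b :- b′) := d :* b :- d :* b′) ≋-refl D B B′)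
                        (≋-trans (+ₚ-cong DB≋DB′ ≋-refl) (+ₚ-inverseʳ (D *ₚ B′)))

  +ₚ-cancelʳ : ∀ C {B B′} → B +ₚ C ≋ B′ +ₚ C → B ≋ B′
  +ₚ-cancelʳ C {B} {B′} e = ≋-trans (solve 2 (λ b c → b := (b :+ c) :- c) ≋-refl B C)
                            (≋-trans (+ₚ-cong e ≋-refl) (solve 2 (λ b c → (b :+ c) :- c := b) ≋-refl B′ C))

  len-*ₚ≤ : ∀ D B e k → len D ≡ suc e → len B ≤ℕ k → len (D *ₚ B) ≤ℕ e +ℕ k
  len-*ₚ≤ D B e k eD lB with ≋[]? B
  ... | yes B≋0 = subst (_≤ℕ e +ℕ k) (sym (≋[]⇒len≡0 (≋-trans (*ₚ-comm D B) (*ₚ-zeroˡ B D B≋0)))) z≤n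
  ... | no B≉0 with ≉[]⇒len≡suc B B≉0
  ... | dB , eB = subst (_≤ℕ e +ℕ k) (trans (ℕP.+-suc e dB) (sym (len-*ₚ D B e dB eD eB))) (ℕP.+-monoʳ-≤ e (subst (_≤ℕ k) eB lB))

  len-quotient≤ : ∀ A Q D e k → A ≋ Q *ₚ D → len D ≡ suc e → len A ≤ℕ e +ℕ k → len Q ≤ℕ k
  len-quotient≤ A Q D e k A≋QD eD lA with ≋[]? Q
  ... | yes Q≋0 = subst (_≤ℕ k) (sym (≋[]⇒len≡0 Q≋0)) z≤n
  ... | no Q≉0 with ≉[]⇒len≡suc Q Q≉0
  ... | dQ , eQ = subst (_≤ℕ k) (sym eQ) (ℕP.+-cancelˡ-≤ e (suc dQ) k (subst (_≤ℕ e +ℕ k) len-A≡e+len-Q lA))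
    where
    len-A≡e+len-Q : len A ≡ e +ℕ suc dQ
    len-A≡e+len-Q = trans (len-cong A≋QD) (trans (len-*ₚ Q D dQ e eQ eD) (trans (cong suc (ℕP.+-comm dQ e)) (sym (ℕP.+-suc e dQ))))

  ∣-len<⇒≋[] : ∀ H X → ¬ (H ≋ []) → H ∣ X → len X <ℕ len H → X ≋ []
  ∣-len<⇒≋[] H X H≉0 H∣X lX = ≋-trans (≋-sym (rem-small X H H≉0 lX)) (∣⇒rem≋[] X H H≉0 H∣X)

  ∣⇒len≤ : ∀ {D X} → ¬ (X ≋ []) → D ∣ X → len D ≤ℕ len X
  ∣⇒len≤ {D} {X} X≉0 (Q , X≋QD) = subst (len D ≤ℕ_) (sym (len-cong X≋QD)) (len-≤*ₚ Q D Q≉0)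
    where
    Q≉0 : ¬ (Q ≋ [])
    Q≉0 Q≋0 = X≉0 (≋-trans X≋QD (*ₚ-zeroˡ Q D Q≋0))

  -- Multiplying by x^(n′ - r) moves the leading coefficient of C mod H to the coefficient read by t_H.
  t-*ₚ-x^ : ∀ {H C n′ r} → len H ≡ suc (suc n′) → len (rem C H) ≡ suc r →
            t H (C *ₚ shift (n′ ∸ r) 1ₚ) ≡ coeff (rem C H) r
  t-*ₚ-x^ {H} {C} {n′} {r} eH eR = begin
    t H (C *ₚ B₀)                     ≡⟨ t-cong-mod H (C *ₚ B₀) (R *ₚ B₀) H≉0 (∣-congʳ C≡R (A∣B*A H (Q *ₚ B₀))) ⟩
    t H (R *ₚ B₀)                     ≡⟨ t-cong H H≉0 (*ₚ-shift-1ₚ i R) ⟩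
    t H (shift i R)                   ≡⟨ t≡coeff H (shift i R) n′ eH ⟩
    coeff (rem (shift i R) H) n′      ≡⟨ coeff-≡ (rem-small (shift i R) H H≉0 len-shift<) n′ ⟩
    coeff (shift i R) n′              ≡⟨ cong (coeff (shift i R)) (sym i+r≡n′) ⟩
    coeff (shift i R) (i +ℕ r)        ≡⟨ coeff-shift i R r ⟩
    coeff R r                         ∎
    where
    open ≡-Reasoning
    H≉0 : ¬ (H ≋ [])
    H≉0 = len≡suc⇒≉[] H eH
    R = rem C H
    i = n′ ∸ r
    B₀ = shift i 1ₚ
    division = rem-spec C H H≉0
    Q = proj₁ (proj₁ division)
    r≤n′ : r ≤ℕ n′
    r≤n′ = ℕP.≤-pred (ℕP.≤-pred (subst₂ _<ℕ_ eR eH (proj₂ division)))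
    i+r≡n′ : i +ℕ r ≡ n′
    i+r≡n′ = ℕP.m∸n+n≡m r≤n′
    len-shift< : len (shift i R) <ℕ len H
    len-shift< = subst₂ _<ℕ_ (sym (trans (len-shift i R r eR) (cong suc i+r≡n′))) (sym eH) ℕP.≤-refl
    C≡R : Q *ₚ B₀ *ₚ H ≋ C *ₚ B₀ -ₚ R *ₚ B₀
    C≡R = ≋-trans (solve 4 (λ q b h r → q :* b :* h := ((q :* h :+ r) :- r) :* b) ≋-refl Q B₀ H R)
                  (≋-trans (*ₚ-congˡ B₀ (+ₚ-cong (≋-sym (proj₂ (proj₁ division))) ≋-refl))
                           (solve 3 (λ c r b → (c :- r) :* b := c :* b :- r :* b) ≋-refl C R B₀))

  ∣-resp-mod : ∀ {P H A D} → P ∣ H → H ∣ A -ₚ D → (P ∣ A → P ∣ D) × (P ∣ D → P ∣ A)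
  ∣-resp-mod {P} {H} {A} {D} P∣H H∣A-D =
    (λ P∣A → ∣-congʳ (solve 2 (λ a d → a :- (a :- d) := d) ≋-refl A D) (∣--ₚ P∣A P∣A-D)) ,
    (λ P∣D → ∣-congʳ (solve 2 (λ a d → (a :- d) :+ d := a) ≋-refl A D) (∣-+ₚ P∣A-D P∣D))
    where
    P∣A-D : P ∣ A -ₚ D
    P∣A-D = ∣-trans P∣H H∣A-D

module PolyFactor (𝔽 : FiniteField) where
  open ≡
  open PolyRing 𝔽
  open PolyDegree 𝔽
  open PolyDivision 𝔽
  open IntegerSolver commutativeRingₚ using (solve; _:+_; _:*_; :-_; _:=_; _:-_)

  open FiniteField 𝔽
  open Polynomials 𝔽
  open IsCommutativeRing isCommutativeRing using (*-comm; *-identityʳ)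

  Irreducible⇒≉[] : ∀ P → Irreducible P → ¬ (P ≋ [])
  Irreducible⇒≉[] P (nz , _ , _) z = nz (coeff-≡ z)

  Irreducible⇒¬Unit : ∀ P → Irreducible P → ¬ Unit P
  Irreducible⇒¬Unit P (_ , nu , _) = nu

  Irreducible-split : ∀ P → Irreducible P → ∀ A B → P ≋ (A *ₚ B) → Unit A ⊎ Unit B
  Irreducible-split P (_ , _ , s) A B e = s A B (coeff-≡ e)

  Bezout : Poly → Poly → Set
  Bezout A M = Σ Poly λ X → Σ Poly λ Y → ((X *ₚ A) +ₚ (Y *ₚ M)) ≋ 1ₚ

  extended-gcd : ∀ f A B → len B <ℕ f → Σ Poly λ g → Σ Poly λ U → Σ Poly λ V → (g ≋ ((U *ₚ A) +ₚ (V *ₚ B))) × g ∣ A × g ∣ B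
  extended-gcd (suc f) A B lt with ≋[]? B
  ... | yes zB = A , 1ₚ , [] , ≋-sym (≋-trans (+ₚ-identityʳ _) (*ₚ-identityˡ A)) , ∣-refl A , ∣-≋[] A B zB
  ... | no nB with rem-spec A B nB
  ...   | (Q , e) , l with extended-gcd f B (rem A B) (ℕP.<-≤-trans l (ℕP.≤-pred lt))
  ...     | g , U' , V' , ge , gB , gr = g , V' , (U' -ₚ (V' *ₚ Q)) , ge' , ∣-congʳ (≋-sym e) (∣-+ₚ (∣B⇒∣A*B Q gB) gr) , gB
    where
    ge' : g ≋ ((V' *ₚ A) +ₚ ((U' -ₚ (V' *ₚ Q)) *ₚ B))
    ge' = ≋-trans ge (≋-sym (≋-trans (+ₚ-cong (*ₚ-congʳ V' e) ≋-refl)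
            (solve 5 (λ v u q b r → ((v :* ((q :* b) :+ r)) :+ ((u :+ (:- (v :* q))) :* b)) := ((u :* b) :+ (v :* r))) ≋-refl V' U' Q B (rem A B))))

  Irreducible⇒Bezout : ∀ P A → Irreducible P → ¬ P ∣ A → Bezout A P
  Irreducible⇒Bezout P A irr nd with extended-gcd (suc (len P)) A P ℕP.≤-refl
  ... | g , U , V , ge , gA , (W , eP) with Irreducible-split P irr W g eP
  ...   | inj₁ uW = ⊥-elim (nd (∣-trans gP gA))
    where
    gP : P ∣ g
    gP with Unit⇒inverse {W} uW
    ... | W' , p = W' , ≋-sym (≋-trans (*ₚ-congʳ W' eP) (≋-trans (solve 3 (λ w' w g → w' :* (w :* g) := (w :* w') :* g) ≋-refl W' W g)
                                                          (≋-trans (*ₚ-congˡ g p) (*ₚ-identityˡ g))))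
  ...   | inj₂ ug with Unit⇒inverse {g} ug
  ...     | h , p = (h *ₚ U) , (h *ₚ V) ,
                    ≋-trans (solve 5 (λ h u a v p → (h :* u) :* a :+ (h :* v) :* p := h :* (u :* a :+ v :* p)) ≋-refl h U A V P)
                                            (≋-trans (*ₚ-congʳ h (≋-sym ge)) (≋-trans (*ₚ-comm h g) p))

  euclid : ∀ P X Y → Irreducible P → P ∣ (X *ₚ Y) → ¬ P ∣ X → P ∣ Y
  euclid P X Y irr d nd with Irreducible⇒Bezout P X irr nd
  ... | U , V , e = ∣-congʳ (≋-trans (≋-trans (*ₚ-congʳ Y e) (*ₚ-comm Y 1ₚ)) (*ₚ-identityˡ Y))
                    (∣-congʳ (solve 5 (λ y u x v p → ((u :* (x :* y)) :+ ((v :* y) :* p)) := (y :* ((u :* x) :+ (v :* p)))) ≋-refl Y U X V P)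
                      (∣-+ₚ (∣B⇒∣A*B U d) (A∣B*A P (V *ₚ Y))))

  Bezout-*ₚ : ∀ A M N → Bezout A M → Bezout A N → Bezout A (M *ₚ N)
  Bezout-*ₚ A M N (U1 , V1 , e1) (U2 , V2 , e2) =
    ((U1 *ₚ U2 *ₚ A) +ₚ ((U1 *ₚ V2 *ₚ N) +ₚ (V1 *ₚ M *ₚ U2))) , (V1 *ₚ V2) ,
    ≋-trans (solve 7 (λ u1 v1 u2 v2 a m n → ((((u1 :* u2) :* a) :+ (((u1 :* v2) :* n) :+ ((v1 :* m) :* u2))) :* a) :+ ((v1 :* v2) :* (m :* n))
                                            := (((u1 :* a) :+ (v1 :* m)) :* ((u2 :* a) :+ (v2 :* n)))) ≋-refl U1 V1 U2 V2 A M N)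
            (≋-trans (*ₚ-cong e1 e2) (*ₚ-identityˡ 1ₚ))

  Bezout⇒Coprime : ∀ A M → Bezout A M → ∀ C → C ∣ A → C ∣ M → Unit C
  Bezout⇒Coprime A M (X , Y , e) C dA dM = ∣1ₚ⇒Unit (∣-congʳ e (∣-+ₚ (∣B⇒∣A*B X dA) (∣B⇒∣A*B Y dM)))

  prod : List Poly → Poly
  prod = foldr _*ₚ_ 1ₚ

  ∈⇒∣prod : ∀ {P} L → Any (λ Q → P ≋ Q) L → P ∣ (prod L)
  ∈⇒∣prod (Q ∷ L) (here p) = ∣-congˡ (≋-sym p) (A∣A*B Q (prod L))
  ∈⇒∣prod (Q ∷ L) (there a) = ∣B⇒∣A*B Q (∈⇒∣prod L a)

  ∤prod : ∀ {P} L → Irreducible P → All (λ Q → ¬ P ∣ Q) L → ¬ P ∣ prod L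
  ∤prod {P} []      iP []          P∣1  = Irreducible⇒¬Unit P iP (∣1ₚ⇒Unit P∣1)
  ∤prod {P} (Q ∷ L) iP (P∤Q ∷ P∤L) P∣QL = ∤prod L iP P∤L (euclid P Q (prod L) iP P∣QL P∤Q)

  prod-∣ : ∀ L G → All Irreducible L → AllPairs (λ P Q → ¬ P ∣ Q) L → All (_∣ G) L → prod L ∣ G
  prod-∣ []      G _          _             _           = 1ₚ∣ G
  prod-∣ (P ∷ L) G (iP ∷ iL) (P∤L ∷ pairs) (P∣G ∷ L∣G) =
    Y , ≋-trans G≋XΠ (≋-trans (*ₚ-congˡ (prod L) X≋YP) (*ₚ-assoc Y P (prod L)))
    where
    Π∣G = prod-∣ L G iL pairs L∣G
    X = proj₁ Π∣G
    G≋XΠ = proj₂ Π∣G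
    P∣X : P ∣ X
    P∣X = euclid P (prod L) X iP (∣-congʳ (≋-trans G≋XΠ (*ₚ-comm X (prod L))) P∣G) (∤prod L iP P∤L)
    Y = proj₁ P∣X
    X≋YP = proj₂ P∣X

  NoSquareFactor : Poly → Set
  NoSquareFactor H = ∀ P → Irreducible P → ¬ (P *ₚ P) ∣ H

  SquareFree⇒NoSquareFactor : ∀ {H} → SquareFree H → NoSquareFactor H
  SquareFree⇒NoSquareFactor (_ , s) P irr d = s P irr (∣⇒∣ₚ d)

  NoSquareFactor-prod-pairwise : ∀ L H → NoSquareFactor H → All Irreducible L → (prod L) ∣ H → AllPairs (λ P Q → ¬ P ∣ Q) L
  NoSquareFactor-prod-pairwise [] H s _ _ = []
  NoSquareFactor-prod-pairwise (P ∷ L) H s (iP ∷ iL) d =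
    All.tabulate (λ {Q} Q∈ dPQ → s P iP (∣-trans (pp Q Q∈ dPQ) d)) ∷
    NoSquareFactor-prod-pairwise L H s iL (∣-trans (A∣B*A (prod L) P) d)
    where
    pp : ∀ Q → Q ∈ L → P ∣ Q → (P *ₚ P) ∣ (P *ₚ prod L)
    pp Q Q∈ (R , e) with ∈⇒∣prod {Q} L (Any.map (λ { refl → ≋-refl }) Q∈)
    ... | (S , e') = (S *ₚ R) , ≋-trans (*ₚ-congʳ P (≋-trans e' (*ₚ-congʳ S e)))
                       (solve 3 (λ p s r → (p :* (s :* (r :* p)))  := ((s :* r) :* (p :* p))) ≋-refl P S R)

  NoSquareFactor-∤ : ∀ P D H → NoSquareFactor H → Irreducible P → (P *ₚ D) ∣ H → ¬ P ∣ D
  NoSquareFactor-∤ P D H s iP d (R , e) =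
    s P iP (∣-trans (R , ≋-trans (*ₚ-congʳ P e) (solve 3 (λ p r q → p :* (r :* q) := r :* (q :* p)) ≋-refl P R P)) d)

  lc-const-*ₚ : ∀ c A → c ≢ 0# → ¬ (A ≋ []) → lc (const c *ₚ A) ≡ c * lc A
  lc-const-*ₚ c A nz nA with ≉[]⇒len≡suc A nA
  ... | dA , eA = trans (lc-*ₚ (const c) A 0 dA (len-const c nz) eA) (cong (_* lc A) (lc≡coeff-deg (const c) 0 (len-const c nz)))

  Unit⇒const : ∀ U → Unit U → (U ≋ const (coeff U 0)) × coeff U 0 ≢ 0#
  Unit⇒const U u = len≤1⇒≋const U (ℕP.≤-reflexive (Unit⇒len≡1 U u)) , coeff-deg≢0 U 0 (Unit⇒len≡1 U u)

  monic-associates-≋ : ∀ P Q → Monic P → Monic Q → Irreducible P → Irreducible Q → P ∣ Q → P ≋ Q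
  monic-associates-≋ P Q mP mQ iP iQ (W , e) with Irreducible-split Q iQ W P e
  ... | inj₂ uP = ⊥-elim (Irreducible⇒¬Unit P iP uP)
  ... | inj₁ uW with Unit⇒const W uW
  ...   | eW , nzw = ≋-sym (≋-trans e (≋-trans (*ₚ-congˡ P eW) (≋-trans (const-*ₚ w P) (≋-trans (scale-congˡ P w1) (scale-1# P)))))
    where
    w = coeff W 0
    w1 : w ≡ 1#
    w1 = trans (sym (*-identityʳ w)) (trans (cong (w *_) (sym mP)) (trans (sym (lc-const-*ₚ w P nzw (Irreducible⇒≉[] P iP)))
           (trans (lc-cong (≋-sym (≋-trans e (*ₚ-congˡ P eW)))) mQ)))

  scale-⁻¹ : ∀ c A → c ≢ 0# → scale (c ⁻¹) (scale c A) ≋ A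
  scale-⁻¹ c A nz = ≋-trans (≋-sym (scale-assoc (c ⁻¹) c A)) (≋-trans (scale-congˡ A (trans (*-comm _ _) (inverseʳ c nz))) (scale-1# A))

  Irreducible-scale : ∀ P c → c ≢ 0# → Irreducible P → Irreducible (scale c P)
  Irreducible-scale P c nz iP = (λ z → Irreducible⇒≉[] P iP (len≡0⇒≋[] P (trans (sym (len-scale c P nz)) (≋[]⇒len≡0 (⟨_⟩ {scale c P} {[]} z)))))
                      , (λ u → Irreducible⇒¬Unit P iP (len≡1⇒Unit P (trans (sym (len-scale c P nz)) (Unit⇒len≡1 (scale c P) u))))
                      , split
    where
    split : ∀ A B → scale c P ≈ₚ (A *ₚ B) → Unit A ⊎ Unit B
    split A B e with Irreducible-split P iP (scale (c ⁻¹) A) B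
                       (≋-trans (≋-sym (scale-⁻¹ c P nz)) (≋-trans (scale-congʳ (⟨_⟩ {scale c P} {A *ₚ B} e)) (≋-sym (scale-*ₚ (c ⁻¹) A B))))
    ... | inj₂ uB = inj₂ uB
    ... | inj₁ uA = inj₁ (len≡1⇒Unit A (trans (sym (len-scale (c ⁻¹) A (x⁻¹≢0 nz))) (Unit⇒len≡1 (scale (c ⁻¹) A) uA)))

  monic : Poly → Poly
  monic W = scale (lc W ⁻¹) W

  monic-Monic : ∀ W → ¬ (W ≋ []) → Monic (monic W)
  monic-Monic W W≉0 with ≉[]⇒len≡suc W W≉0
  ... | d , eW = trans (lc-cong (≋-sym (const-*ₚ _ W)))
                   (trans (lc-const-*ₚ _ W (x⁻¹≢0 (lc≢0 W d eW)) W≉0) (trans (*-comm _ _) (inverseʳ (lc W) (lc≢0 W d eW))))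

  monic-∣ : ∀ W → ¬ (W ≋ []) → monic W ∣ W
  monic-∣ W W≉0 with ≉[]⇒len≡suc W W≉0
  ... | d , eW = const (lc W) , ≋-sym (≋-trans (const-*ₚ _ _) (≋-trans (≋-sym (scale-assoc (lc W) (lc W ⁻¹) W))
                                       (≋-trans (scale-congˡ W (inverseʳ (lc W) (lc≢0 W d eW))) (scale-1# W))))

  2≤len : ∀ A → ¬ (A ≋ []) → ¬ Unit A → 2 ≤ℕ len A
  2≤len A A≉0 ¬uA with len A in eq
  ... | zero        = ⊥-elim (A≉0 (len≡0⇒≋[] A eq))
  ... | suc zero    = ⊥-elim (¬uA (len≡1⇒Unit A eq))
  ... | suc (suc _) = s≤s (s≤s z≤n)

  private
    -- Since the goal is ⊥, we may case on whether W splits into two non-units.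
    ¬¬factor : ∀ f W → len W <ℕ f → ¬ (W ≋ []) → ¬ Unit W → (∀ P → Irreducible P → Monic P → ¬ P ∣ W) → ⊥
    ¬¬factor (suc f) W lW W≉0 ¬uW none = ¬¬-excluded-middle (λ { (yes split) → splits split ; (no ¬split) → irreducible ¬split })
      where
      Splits = Σ Poly λ A → Σ Poly λ B → W ≋ A *ₚ B × ¬ Unit A × ¬ Unit B
      splits : Splits → ⊥
      splits (A , B , W≋AB , ¬uA , ¬uB) =
        ¬¬factor f A (ℕP.<-≤-trans len-A<len-W (ℕP.≤-pred lW)) A≉0 ¬uA
                 (λ P iP mP P∣A → none P iP mP (∣-trans P∣A (B , ≋-trans W≋AB (*ₚ-comm A B))))
        where
        A≉0 : ¬ (A ≋ [])
        A≉0 A≋0 = W≉0 (≋-trans W≋AB (*ₚ-zeroˡ A B A≋0))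
        B≉0 : ¬ (B ≋ [])
        B≉0 B≋0 = W≉0 (≋-trans W≋AB (≋-trans (*ₚ-comm A B) (*ₚ-zeroˡ B A B≋0)))
        dA = proj₁ (≉[]⇒len≡suc A A≉0)
        eA = proj₂ (≉[]⇒len≡suc A A≉0)
        dB = proj₁ (≉[]⇒len≡suc B B≉0)
        eB = proj₂ (≉[]⇒len≡suc B B≉0)
        1≤dB : 1 ≤ℕ dB
        1≤dB = ℕP.≤-pred (subst (2 ≤ℕ_) eB (2≤len B B≉0 ¬uB))
        len-A<len-W : len A <ℕ len W
        len-A<len-W = subst₂ _<ℕ_ (sym eA) (sym (trans (len-cong W≋AB) (len-*ₚ A B dA dB eA eB)))
                        (s≤s (subst (_≤ℕ dA +ℕ dB) (ℕP.+-comm dA 1) (ℕP.+-monoʳ-≤ dA 1≤dB)))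
      irreducible : ¬ Splits → ⊥
      irreducible ¬split = none (monic W) (Irreducible-scale W _ (x⁻¹≢0 (lc≢0 W _ (proj₂ (≉[]⇒len≡suc W W≉0)))) irrW)
                                (monic-Monic W W≉0) (monic-∣ W W≉0)
        where
        irrW : Irreducible W
        irrW = (λ W≈0 → W≉0 ⟨ W≈0 ⟩) , ¬uW , split
          where
          split : ∀ A B → W ≈ₚ A *ₚ B → Unit A ⊎ Unit B
          split A B W≈AB with Unit? A | Unit? B
          ... | yes uA | _      = inj₁ uA
          ... | no _   | yes uB = inj₂ uB
          ... | no ¬uA | no ¬uB = ⊥-elim (¬split (A , B , ⟨_⟩ {W} {A *ₚ B} W≈AB , ¬uA , ¬uB))

  ¬¬∃-monic-irreducible-∣ : ∀ W → ¬ (W ≋ []) → ¬ Unit W → ¬ (∀ P → Irreducible P → Monic P → ¬ P ∣ W)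
  ¬¬∃-monic-irreducible-∣ W = ¬¬factor (suc (len W)) W ℕP.≤-refl

  ≋Unit*⇒∣ : ∀ U {X Y} → Unit U → X ≋ U *ₚ Y → X ∣ Y
  ≋Unit*⇒∣ U {X} {Y} u X≋UY with Unit⇒inverse {U} u
  ... | V , UV≋1 = V , ≋-trans (≋-sym (*ₚ-identityˡ Y)) (≋-trans (*ₚ-congˡ Y (≋-trans (≋-sym UV≋1) (*ₚ-comm U V)))
                         (≋-trans (*ₚ-assoc V U Y) (*ₚ-congʳ V (≋-sym X≋UY))))

  Bezout-prod : ∀ A L → All Irreducible L → All (λ P → ¬ P ∣ A) L → Bezout A (prod L)
  Bezout-prod A []      _          _          = [] , 1ₚ , *ₚ-identityˡ 1ₚ
  Bezout-prod A (P ∷ L) (iP ∷ iL) (P∤A ∷ L∤A) = Bezout-*ₚ A P (prod L) (Irreducible⇒Bezout P A iP P∤A) (Bezout-prod A L iL L∤A)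

  deg : Poly → ℕ
  deg P = len P ∸ 1

  len-prod : ∀ L → All (λ P → ¬ (P ≋ [])) L → len (prod L) ≡ suc (sum (map deg L))
  len-prod []      _          = len-1ₚ
  len-prod (P ∷ L) (P≉0 ∷ L≉0) with ≉[]⇒len≡suc P P≉0
  ... | d , eP = trans (len-*ₚ P (prod L) d (sum (map deg L)) eP (len-prod L L≉0)) (cong (λ k → suc (k +ℕ sum (map deg L))) (sym (cong (_∸ 1) eP)))

  Irreducible-*ₚ-∣ : ∀ {P D A} → Irreducible P → ¬ P ∣ D → D ∣ A → P ∣ A → P *ₚ D ∣ A
  Irreducible-*ₚ-∣ {P} {D} {A} iP P∤D (X , A≋XD) P∣A = Y , ≋-trans A≋XD (≋-trans (*ₚ-congˡ D X≋YP) (*ₚ-assoc Y P D))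
    where
    P∣X : P ∣ X
    P∣X = euclid P D X iP (∣-congʳ (≋-trans A≋XD (*ₚ-comm X D)) P∣A) P∤D
    Y = proj₁ P∣X
    X≋YP = proj₂ P∣X

  len-prod-Irreducible : ∀ {L} → All Irreducible L → len (prod L) ≡ suc (sum (map deg L))
  len-prod-Irreducible {L} iL = len-prod L (All.map (λ {P} → Irreducible⇒≉[] P) iL)

module SquareFreeStructure (𝔽 : FiniteField) where
  open Data.Integer using (+_)
  open ≡ using (refl)
  open PolyRing 𝔽
  open PolyDegree 𝔽
  open PolyDivision 𝔽
  open PolyFactor 𝔽
  open IntegerSolver commutativeRingₚ using (solve; _:*_; _:=_)

  open FiniteField 𝔽
  open Polynomials 𝔽

  -- The data carried by a nonzero value of the Möbius function.
  record PrimeFactorisation (H : Poly) : Set where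
    field
      factors           : List Poly
      factors-valid     : All (λ P → Monic P × Irreducible P × P ∣ₚ H) factors
      factors-distinct  : AllPairs (λ P Q → ¬ (P ≈ₚ Q)) factors
      factors-complete  : ∀ P → Monic P → Irreducible P → P ∣ₚ H → Any (P ≈ₚ_) factors

  MobiusValue⇒PrimeFactorisation : ∀ H {μ} → SquareFree H → MobiusValue H μ →
    Σ (PrimeFactorisation H) (λ F → μ ≡ (ℤ.- (+ 1)) ℤ.^ length (PrimeFactorisation.factors F))
  MobiusValue⇒PrimeFactorisation _ sf (inj₁ (inj₁ H≈0 , _))          = ⊥-elim (proj₁ sf H≈0)
  MobiusValue⇒PrimeFactorisation _ sf (inj₁ (inj₂ (P , iP , P²∣H) , _)) = ⊥-elim (proj₂ sf P iP P²∣H)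
  MobiusValue⇒PrimeFactorisation _ sf (inj₂ (_ , _ , Ps , valid , distinct , complete , μ≡)) =
    record { factors = Ps ; factors-valid = valid ; factors-distinct = distinct ; factors-complete = complete } , μ≡

  module SquareFreeFactorisation {H : Poly} (sf : SquareFree H) (F : PrimeFactorisation H) where
    open PrimeFactorisation F

    H≉[] : ¬ (H ≋ [])
    H≉[] z = proj₁ sf (coeff-≡ z)

    H-noSquareFactor : NoSquareFactor H
    H-noSquareFactor = SquareFree⇒NoSquareFactor sf

    factors-irreducible : All Irreducible factors
    factors-irreducible = All.map (λ (_ , iP , _) → iP) factors-valid

    factors-∣ : All (_∣ H) factors
    factors-∣ = All.map (λ (_ , _ , P∣H) → ∣ₚ⇒∣ P∣H) factors-valid

    factors-pairwise-∤ : AllPairs (λ P Q → ¬ P ∣ Q) factors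
    factors-pairwise-∤ = AllPairs-mapWithAll
      (λ { {P} {Q} (mP , iP , _) (mQ , iQ , _) P≉Q P∣Q → P≉Q (coeff-≡ (monic-associates-≋ P Q mP mQ iP iQ P∣Q)) })
      factors-valid factors-distinct

    private
      prod-factors-∣ : prod factors ∣ H
      prod-factors-∣ = prod-∣ factors H factors-irreducible factors-pairwise-∤ factors-∣

    cofactor : Poly
    cofactor = proj₁ prod-factors-∣

    H≋cofactor*prod : H ≋ cofactor *ₚ prod factors
    H≋cofactor*prod = proj₂ prod-factors-∣

    -- An irreducible factor of the cofactor would divide H twice.
    cofactor-unit : Unit cofactor
    cofactor-unit with Unit? cofactor
    ... | yes u  = u
    ... | no ¬u = ⊥-elim (¬¬∃-monic-irreducible-∣ W W≉[] ¬u no-factor)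
      where
      W = cofactor
      W≉[] : ¬ (W ≋ [])
      W≉[] z = H≉[] (≋-trans H≋cofactor*prod (*ₚ-zeroˡ W (prod factors) z))
      no-factor : ∀ P → Irreducible P → Monic P → ¬ P ∣ W
      no-factor P iP mP (X , W≋XP) = H-noSquareFactor P iP (∣-congʳ (≋-sym H≋cofactor*prod) P²∣W*prod)
        where
        P∣H : P ∣ H
        P∣H = ∣-trans (X , W≋XP) (∣-congʳ (≋-sym H≋cofactor*prod) (A∣A*B W (prod factors)))
        P∣prod : P ∣ prod factors
        P∣prod = ∈⇒∣prod factors (Any.map (λ {Q} e → ⟨_⟩ {P} {Q} e) (factors-complete P mP iP (∣⇒∣ₚ P∣H)))
        Y = proj₁ P∣prod
        P²∣W*prod : (P *ₚ P) ∣ (W *ₚ prod factors)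
        P²∣W*prod = (X *ₚ Y) , ≋-trans (*ₚ-cong W≋XP (proj₂ P∣prod))
                                       (solve 3 (λ x p y → (x :* p) :* (y :* p) := (x :* y) :* (p :* p)) ≋-refl X P Y)

    H∣prod-factors : H ∣ prod factors
    H∣prod-factors = ≋Unit*⇒∣ cofactor cofactor-unit H≋cofactor*prod

    ∤factors⇒Coprime : ∀ A → All (λ P → ¬ P ∣ A) factors → Coprime A H
    ∤factors⇒Coprime A ∤A C C∣A C∣H with Bezout-prod A factors factors-irreducible ∤A | H∣prod-factors
    ... | X , Y , XA+Y*prod≋1 | V , prod≋VH =
      Bezout⇒Coprime A H (X , (Y *ₚ V) , ≋-trans (+ₚ-cong ≋-refl (≋-trans (*ₚ-assoc Y V H) (*ₚ-congʳ Y (≋-sym prod≋VH)))) XA+Y*prod≋1)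
                     C (∣ₚ⇒∣ C∣A) (∣ₚ⇒∣ C∣H)

    Coprime⇒∤factors : ∀ {A} → Coprime A H → All (λ P → ¬ P ∣ A) factors
    Coprime⇒∤factors A⊥H = All.zipWith (λ { {P} (iP , P∣H) P∣A → Irreducible⇒¬Unit P iP (A⊥H P (∣⇒∣ₚ P∣A) (∣⇒∣ₚ P∣H)) })
                                       (factors-irreducible , factors-∣)

module PolyEnumeration (𝔽 : FiniteField) where
  open ≡
  open PolyRing 𝔽
  open PolyDegree 𝔽
  open PolyDivision 𝔽 using (length-strip≤)

  open FiniteField 𝔽
  open Polynomials 𝔽

  q : ℕ
  q = length elements

  -- All coefficient lists of length exactly k, i.e. one representative of every polynomial of degree < k.
  polys< : ℕ → List Poly
  polys< zero    = [] ∷ []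
  polys< (suc k) = concatMap (λ a → map (a ∷_) (polys< k)) elements

  polys<-length : ∀ k → All (λ B → length B ≡ k) (polys< k)
  polys<-length zero    = refl ∷ []
  polys<-length (suc k) = All.concat⁺ (All.map⁺ {f = λ a → map (a ∷_) (polys< k)} (All.tabulate {xs = elements} (λ _ → block)))
    where
    block : ∀ {a} → All (λ B → length B ≡ suc k) (map (a ∷_) (polys< k))
    block = All.map⁺ (All.map (cong suc) (polys<-length k))

  polys<-len≤ : ∀ k → All (λ B → len B ≤ℕ k) (polys< k)
  polys<-len≤ k = All.map (λ {B} e → subst (len B ≤ℕ_) e (length-strip≤ B)) (polys<-length k)

  polys<-count : ∀ k → length (polys< k) ≡ q ℕ.^ k
  polys<-count zero    = refl
  polys<-count (suc k) = trans (blocks elements) (cong (q *ℕ_) (polys<-count k))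
    where
    blocks : ∀ L → length (concatMap (λ a → map (a ∷_) (polys< k)) L) ≡ length L *ℕ length (polys< k)
    blocks []      = refl
    blocks (a ∷ L) = trans (List.length-++ (map (a ∷_) (polys< k))) (cong₂ _+ℕ_ (List.length-map (a ∷_) (polys< k)) (blocks L))

  private
    tail : Poly → Poly
    tail []      = []
    tail (a ∷ A) = A

    ≋coeff0∷tail : ∀ A → A ≋ coeff A 0 ∷ tail A
    ≋coeff0∷tail []      = ≋-sym 0∷[]≋[]
    ≋coeff0∷tail (a ∷ A) = ≋-refl

    len-tail≤ : ∀ A k → len A ≤ℕ suc k → len (tail A) ≤ℕ k
    len-tail≤ A k p = len≤ (tail A) k (λ i r → trans (sym (coeff-≡ (≋coeff0∷tail A) (suc i))) (coeff-≥len A (suc i) (ℕP.≤-trans p (s≤s r))))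

  polys<-complete : ∀ k A → len A ≤ℕ k → Any (_≋ A) (polys< k)
  polys<-complete zero    A p = here (≋-sym (len≡0⇒≋[] A (ℕP.n≤0⇒n≡0 p)))
  polys<-complete (suc k) A p = Any.concat⁺ (Any.map⁺ (Any.map (λ { refl → Any.map⁺ (Any.map a∷B≋A tail-found) }) (complete (coeff A 0))))
    where
    tail-found = polys<-complete k (tail A) (len-tail≤ A k p)
    a∷B≋A : ∀ {B} → B ≋ tail A → coeff A 0 ∷ B ≋ A
    a∷B≋A B≋ = ≋-trans (∷-cong refl B≋) (≋-sym (≋coeff0∷tail A))

  polys<-distinct : ∀ k → AllPairs (λ B B′ → ¬ B ≋ B′) (polys< k)
  polys<-distinct zero    = [] ∷ []
  polys<-distinct (suc k) = AllPairs.concat⁺ (All.map⁺ (All.tabulate (λ {a} _ → within a))) (AllPairs.map⁺ (AllPairs.map across unique))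
    where
    within : ∀ a → AllPairs (λ B B′ → ¬ B ≋ B′) (map (a ∷_) (polys< k))
    within a = AllPairs.map⁺ (AllPairs.map (λ B≉B′ e → B≉B′ (proj₂ (∷-injective e))) (polys<-distinct k))
    across : ∀ {a a′} → a ≢ a′ → All (λ B → All (λ B′ → ¬ B ≋ B′) (map (a′ ∷_) (polys< k))) (map (a ∷_) (polys< k))
    across a≢a′ = All.map⁺ (All.tabulate (λ _ → All.map⁺ (All.tabulate (λ _ e → a≢a′ (proj₁ (∷-injective e))))))

module CharacterSums (𝔽 : FiniteField) (R : CommutativeRing 0ℓ 0ℓ) (idom : IsIntegralDomain R) (ψ : AdditiveCharacter 𝔽 R) where

  open PolyRing 𝔽
  open PolyDegree 𝔽
  open PolyDivision 𝔽
  open PolyEnumeration 𝔽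
  open FiniteSums R
  open IntegerSolver R using (natR-*)
  open IntegerSolver commutativeRingₚ using (solve; _:+_; _:*_; _:-_; _:=_)

  private module 𝔽 = FiniteField 𝔽
  open 𝔽 using (_⁻¹) renaming (Carrier to F)
  open Polynomials 𝔽
  open Sums 𝔽 R ψ
  open CommutativeRing R
  open AdditiveCharacter ψ
  open RingProperties ring using (x[y-z]≈xy-xz)
  open SetoidReasoning setoid

  q^ : ℕ → Carrier
  q^ k = natR R (length (polys< k))

  q^-+ : ∀ a b → q^ (a +ℕ b) ≈ q^ a * q^ b
  q^-+ a b = trans (reflexive (≡.cong (natR R) count)) (natR-* (length (polys< a)) (length (polys< b)))
    where
    count : length (polys< (a +ℕ b)) ≡ length (polys< a) ℕ.* length (polys< b)
    count = ≡.trans (polys<-count (a +ℕ b)) (≡.trans (ℕP.^-distribˡ-+-* q a b) (≡.cong₂ ℕ._*_ (≡.sym (polys<-count a)) (≡.sym (polys<-count b))))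

  polys<-atMostOne : ∀ k {p : Poly → Set} → (∀ {B B′} → len B ≤ℕ k → len B′ ≤ℕ k → p B → p B′ → B ≋ B′) →
                     AtMostOne p (polys< k)
  polys<-atMostOne k same = AllPairs-mapWithAll (λ lB lB′ B≉B′ pB pB′ → B≉B′ (same lB lB′ pB pB′)) (polys<-len≤ k) (polys<-distinct k)

  polys<-any : ∀ k {p : Poly → Set} {X} → len X ≤ℕ k → (∀ {B} → B ≋ X → p B) → Any p (polys< k)
  polys<-any k lX p≋ = Any.map p≋ (polys<-complete k _ lX)

  fixed⇒≈0# : ∀ S c → S * c ≈ S → ¬ c ≈ 1# → S ≈ 0#
  fixed⇒≈0# S c Sc≈S c≉1 with proj₂ idom S (c - 1#) S[c-1]≈0
    where
    S[c-1]≈0 : S * (c - 1#) ≈ 0#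
    S[c-1]≈0 = trans (x[y-z]≈xy-xz S c 1#) (trans (+-cong Sc≈S (-‿cong (*-identityʳ S))) (-‿inverseʳ S))
  ... | inj₁ S≈0   = S≈0
  ... | inj₂ c-1≈0 = ⊥-elim (c≉1 (begin
    c               ≈⟨ sym (+-identityʳ c) ⟩
    c + 0#          ≈⟨ +-congˡ (sym (-‿inverseˡ 1#)) ⟩
    c + (- 1# + 1#) ≈⟨ sym (+-assoc _ _ _) ⟩
    (c - 1#) + 1#   ≈⟨ +-congʳ c-1≈0 ⟩
    0# + 1#         ≈⟨ +-identityˡ 1# ⟩
    1#              ∎))

  module _ (e k : ℕ) {D : Poly} (D≉0 : ¬ (D ≋ [])) (eD : len D ≡ suc e)
           (f : Poly → Carrier) (f-cong : ∀ {A B} → A ≋ B → f A ≈ f B) where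

    ∑-multiples : ∑ (polys< (e +ℕ k)) (λ A → ind₀ (D ∣? A) (f A)) ≈ ∑ (polys< k) (λ B → f (D *ₚ B))
    ∑-multiples = ∑-matching (λ A B → A ≋? D *ₚ B) (polys< (e +ℕ k)) (polys< k) _ _ matched
      (All.map row (polys<-len≤ (e +ℕ k))) (All.map column (polys<-len≤ k))
      where
      matched : ∀ {A B} → A ≋ D *ₚ B → ind₀ (D ∣? A) (f A) ≈ f (D *ₚ B)
      matched {A} {B} A≋DB = trans (ind₀-yes (D ∣? A) (f A) (B , ≋-trans A≋DB (*ₚ-comm D B))) (f-cong A≋DB)
      row : ∀ {A} → len A ≤ℕ e +ℕ k → AtMostOne (λ B → A ≋ D *ₚ B) (polys< k) ×
                                       (Any (λ B → A ≋ D *ₚ B) (polys< k) ⊎ ind₀ (D ∣? A) (f A) ≈ 0#)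
      row {A} lA = polys<-atMostOne k (λ _ _ A≋DB A≋DB′ → *ₚ-cancelˡ D D≉0 (≋-trans (≋-sym A≋DB) A≋DB′)) , quotient (D ∣? A)
        where
        quotient : ∀ d → Any (λ B → A ≋ D *ₚ B) (polys< k) ⊎ ind₀ d (f A) ≈ 0#
        quotient (yes (Q , A≋QD)) = inj₁ (polys<-any k (len-quotient≤ A Q D e k A≋QD eD lA)
                                            (λ B≋Q → ≋-trans A≋QD (≋-trans (*ₚ-comm Q D) (*ₚ-congʳ D (≋-sym B≋Q)))))
        quotient (no _)           = inj₂ refl
      column : ∀ {B} → len B ≤ℕ k → AtMostOne (_≋ D *ₚ B) (polys< (e +ℕ k)) ×
                                     (Any (_≋ D *ₚ B) (polys< (e +ℕ k)) ⊎ f (D *ₚ B) ≈ 0#)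
      column {B} lB = polys<-atMostOne (e +ℕ k) (λ _ _ A≋DB A′≋DB → ≋-trans A≋DB (≋-sym A′≋DB)) ,
                      inj₁ (polys<-any (e +ℕ k) (len-*ₚ≤ D B e k eD lB) (λ A≋DB → A≋DB))

  module _ (ℓ : Poly → F) (ℓ-cong : ∀ {A B} → A ≋ B → ℓ A ≡ ℓ B)
           (ℓ-+ : ∀ A B → ℓ (A +ₚ B) ≡ ℓ A 𝔽.+ ℓ B) (ℓ-scale : ∀ c A → ℓ (scale c A) ≡ c 𝔽.* ℓ A) where

    -- Translation by a B₁ with ℓ B₁ = a permutes the summands and multiplies the sum by λ a ≠ 1.
    ∑-λ∘linear≈0# : ∀ k {B₀} → len B₀ ≤ℕ k → ℓ B₀ ≢ 𝔽.0# → ∑ (polys< k) (λ B → λ-fun (ℓ B)) ≈ 0#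
    ∑-λ∘linear≈0# k {B₀} lB₀ ℓB₀≢0 = fixed⇒≈0# S (λ-fun a) S*λa≈S (proj₂ nontrivial)
      where
      open IsCommutativeRing 𝔽.isCommutativeRing using () renaming (*-assoc to *F-assoc; *-comm to *F-comm; *-identityʳ to *F-identityʳ)
      a : F
      a = proj₁ nontrivial
      S : Carrier
      S = ∑ (polys< k) (λ B → λ-fun (ℓ B))
      c : F
      c = a 𝔽.* ℓ B₀ ⁻¹
      B₁ : Poly
      B₁ = scale c B₀
      ℓB₁≡a : ℓ B₁ ≡ a
      ℓB₁≡a = ≡.trans (ℓ-scale c B₀) (≡.trans (*F-assoc a _ _)
                (≡.trans (≡.cong (a 𝔽.*_) (≡.trans (*F-comm _ _) (𝔽.inverseʳ (ℓ B₀) ℓB₀≢0))) (*F-identityʳ a)))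
      lB₁ : len B₁ ≤ℕ k
      lB₁ = ℕP.≤-trans (len-scale≤ c B₀) lB₀
      translation : ∑ (polys< k) (λ B → λ-fun (ℓ (B +ₚ B₁))) ≈ S
      translation = ∑-matching (λ B B′ → B′ ≋? B +ₚ B₁) (polys< k) (polys< k) _ _
        (λ B′≋B+B₁ → reflexive (≡.cong λ-fun (ℓ-cong (≋-sym B′≋B+B₁))))
        (All.map row (polys<-len≤ k)) (All.map column (polys<-len≤ k))
        where
        row : ∀ {B} → len B ≤ℕ k → AtMostOne (_≋ B +ₚ B₁) (polys< k) × (Any (_≋ B +ₚ B₁) (polys< k) ⊎ _)
        row {B} lB = polys<-atMostOne k (λ _ _ e e′ → ≋-trans e (≋-sym e′)) ,
                     inj₁ (polys<-any k (len-+ₚ≤ B B₁ k lB lB₁) (λ e → e))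
        column : ∀ {B′} → len B′ ≤ℕ k → AtMostOne (λ B → B′ ≋ B +ₚ B₁) (polys< k) × (Any (λ B → B′ ≋ B +ₚ B₁) (polys< k) ⊎ _)
        column {B′} lB′ = polys<-atMostOne k (λ _ _ e e′ → +ₚ-cancelʳ B₁ (≋-trans (≋-sym e) e′)) ,
                          inj₁ (polys<-any k (len-+ₚ≤ B′ (negₚ B₁) k lB′ (≡.subst (_≤ℕ k) (≡.sym (len-negₚ B₁)) lB₁))
                                 (λ B≋B′-B₁ → ≋-trans (solve 2 (λ b′ b₁ → b′ := (b′ :- b₁) :+ b₁) ≋-refl B′ B₁)
                                                      (+ₚ-cong (≋-sym B≋B′-B₁) ≋-refl)))
      S*λa≈S : S * λ-fun a ≈ S
      S*λa≈S = begin
        S * λ-fun a                                   ≈⟨ *-comm _ _ ⟩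
        λ-fun a * S                                   ≈⟨ sym (∑-* (polys< k) (λ-fun a) (λ B → λ-fun (ℓ B))) ⟩
        ∑ (polys< k) (λ B → λ-fun a * λ-fun (ℓ B))    ≈⟨ ∑-cong (polys< k) translate ⟩
        ∑ (polys< k) (λ B → λ-fun (ℓ (B +ₚ B₁)))      ≈⟨ translation ⟩
        S                                             ∎
        where
        translate : ∀ B → λ-fun a * λ-fun (ℓ B) ≈ λ-fun (ℓ (B +ₚ B₁))
        translate B = begin
          λ-fun a * λ-fun (ℓ B)      ≈⟨ *-comm _ _ ⟩
          λ-fun (ℓ B) * λ-fun a      ≈⟨ sym (λ-hom (ℓ B) a) ⟩
          λ-fun (ℓ B 𝔽.+ a)          ≡⟨ ≡.cong λ-fun (≡.sym (≡.trans (ℓ-+ B B₁) (≡.cong (ℓ B 𝔽.+_) ℓB₁≡a))) ⟩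
          λ-fun (ℓ (B +ₚ B₁))        ∎

  E-cong : ∀ G {H} → ¬ (H ≋ []) → ∀ {A B} → A ≋ B → E G H A ≈ E G H B
  E-cong G {H} H≉0 A≋B = reflexive (≡.cong λ-fun (t-cong H H≉0 (*ₚ-congʳ G A≋B)))

  module _ (G : Poly) {H : Poly} (n : ℕ) (eH : len H ≡ suc n) where

    private
      <⇒≡suc-pred : ∀ {r m} → r <ℕ m → m ≡ suc (ℕ.pred m)
      <⇒≡suc-pred {m = suc _} _ = ≡.refl

      H≉0 : ¬ (H ≋ [])
      H≉0 = len≡suc⇒≉[] H eH

      t-witness : ∀ {C D} e → len D ≡ suc e → D ∣ H → D ∣ C → ¬ H ∣ C →
                  Σ Poly λ B₀ → len B₀ ≤ℕ n ∸ e × t H (C *ₚ B₀) ≢ 𝔽.0#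
      t-witness {C} {D} e eD D∣H D∣C H∤C = shift (n′ ∸ r) 1ₚ , len-B₀≤ , t≢0
        where
        Rm = rem C H
        Rm≉0 : ¬ (Rm ≋ [])
        Rm≉0 Rm≋0 = H∤C (rem≋[]⇒∣ C H H≉0 Rm≋0)
        r = proj₁ (≉[]⇒len≡suc Rm Rm≉0)
        eRm : len Rm ≡ suc r
        eRm = proj₂ (≉[]⇒len≡suc Rm Rm≉0)
        r<n : r <ℕ n
        r<n = ℕP.≤-pred (≡.subst₂ _<ℕ_ eRm eH (proj₂ (rem-spec C H H≉0)))
        n′ = ℕ.pred n
        n≡1+n′ : n ≡ suc n′
        n≡1+n′ = <⇒≡suc-pred r<n
        r≤n′ : r ≤ℕ n′
        r≤n′ = ℕP.≤-pred (≡.subst (suc r ≤ℕ_) n≡1+n′ r<n)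
        e≤r : e ≤ℕ r
        e≤r = ℕP.≤-pred (≡.subst₂ _≤ℕ_ eD eRm (∣⇒len≤ Rm≉0 (∣-rem D C H H≉0 D∣H D∣C)))
        len-B₀≤ : len (shift (n′ ∸ r) 1ₚ) ≤ℕ n ∸ e
        len-B₀≤ = ≡.subst₂ _≤ℕ_ (≡.sym len-B₀) (≡.cong (_∸ e) (≡.sym n≡1+n′)) (ℕP.∸-monoʳ-≤ (suc n′) e≤r)
          where
          len-B₀ : len (shift (n′ ∸ r) 1ₚ) ≡ suc n′ ∸ r
          len-B₀ = ≡.trans (len-shift (n′ ∸ r) 1ₚ 0 len-1ₚ)
                     (≡.trans (≡.cong suc (ℕP.+-identityʳ (n′ ∸ r))) (≡.sym (ℕP.+-∸-assoc 1 r≤n′)))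
        t≢0 : t H (C *ₚ shift (n′ ∸ r) 1ₚ) ≢ 𝔽.0#
        t≢0 t≡0 = coeff-deg≢0 Rm r eRm (≡.trans (≡.sym (t-*ₚ-x^ {H} {C} {n′} {r} (≡.trans eH (≡.cong suc n≡1+n′)) eRm)) t≡0)

    ∑-E-multiples : ∀ {D} e → len D ≡ suc e → D ∣ H →
                    ∑ (polys< n) (λ A → ind₀ (D ∣? A) (E G H A)) ≈ ind₀ (H ∣? G *ₚ D) (q^ (n ∸ e))
    ∑-E-multiples {D} e eD D∣H = begin
      ∑ (polys< n) (λ A → ind₀ (D ∣? A) (E G H A))        ≡⟨ ≡.cong (λ m → ∑ (polys< m) (λ A → ind₀ (D ∣? A) (E G H A))) n≡e+k ⟩
      ∑ (polys< (e +ℕ k)) (λ A → ind₀ (D ∣? A) (E G H A)) ≈⟨ ∑-multiples e k D≉0 eD (E G H) (E-cong G H≉0) ⟩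
      ∑ (polys< k) (λ B → E G H (D *ₚ B))                 ≈⟨ by-cases (H ∣? G *ₚ D) ⟩
      ind₀ (H ∣? G *ₚ D) (q^ k)                           ∎
      where
      k = n ∸ e
      D≉0 : ¬ (D ≋ [])
      D≉0 = len≡suc⇒≉[] D eD
      n≡e+k : n ≡ e +ℕ k
      n≡e+k = ≡.sym (ℕP.m+[n∸m]≡n (ℕP.≤-pred (≡.subst₂ _≤ℕ_ eD eH (∣⇒len≤ H≉0 D∣H))))
      ℓ : Poly → F
      ℓ B = t H (G *ₚ (D *ₚ B))
      ℓ-cong : ∀ {A B} → A ≋ B → ℓ A ≡ ℓ B
      ℓ-cong A≋B = t-cong H H≉0 (*ₚ-congʳ G (*ₚ-congʳ D A≋B))
      ℓ-+ : ∀ A B → ℓ (A +ₚ B) ≡ ℓ A 𝔽.+ ℓ B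
      ℓ-+ A B = ≡.trans (t-cong H H≉0 (solve 4 (λ g d a b → g :* (d :* (a :+ b)) := g :* (d :* a) :+ g :* (d :* b)) ≋-refl G D A B))
                        (t-+ₚ H (G *ₚ (D *ₚ A)) (G *ₚ (D *ₚ B)) H≉0)
      ℓ-scale : ∀ c A → ℓ (scale c A) ≡ c 𝔽.* ℓ A
      ℓ-scale c A = ≡.trans (t-cong H H≉0 GD[cA]≋c[GDA]) (t-scale H c (G *ₚ (D *ₚ A)) H≉0)
        where
        GD[cA]≋c[GDA] : G *ₚ (D *ₚ scale c A) ≋ scale c (G *ₚ (D *ₚ A))
        GD[cA]≋c[GDA] = ≋-trans (*ₚ-congʳ G (*ₚ-congʳ D (≋-sym (const-*ₚ c A))))
                       (≋-trans (solve 4 (λ g d x a → g :* (d :* (x :* a)) := x :* (g :* (d :* a))) ≋-refl G D (const c) A)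
                                (const-*ₚ c (G *ₚ (D *ₚ A))))
      by-cases : (d : Dec (H ∣ G *ₚ D)) → ∑ (polys< k) (λ B → E G H (D *ₚ B)) ≈ ind₀ d (q^ k)
      by-cases (yes H∣GD) = trans (∑-cong (polys< k) E≈1) (∑-1# (polys< k))
        where
        E≈1 : ∀ B → E G H (D *ₚ B) ≈ 1#
        E≈1 B = trans (reflexive (≡.cong λ-fun (t-∣ H (G *ₚ (D *ₚ B)) H≉0 H∣GDB))) λ-zero
          where
          H∣GDB : H ∣ G *ₚ (D *ₚ B)
          H∣GDB = ∣-congʳ (*ₚ-assoc G D B) (∣A⇒∣A*B B H∣GD)
      by-cases (no H∤GD) = ∑-λ∘linear≈0# ℓ ℓ-cong ℓ-+ ℓ-scale k (proj₁ (proj₂ witness)) ℓB₀≢0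
        where
        witness = t-witness e eD D∣H (A∣B*A D G) H∤GD
        B₀ = proj₁ witness
        ℓB₀≢0 : ℓ B₀ ≢ 𝔽.0#
        ℓB₀≢0 ℓB₀≡0 = proj₂ (proj₂ witness) (≡.trans (t-cong H H≉0 (*ₚ-assoc G D B₀)) ℓB₀≡0)

module InclusionExclusion (𝔽 : FiniteField) (R : CommutativeRing 0ℓ 0ℓ) (idom : IsIntegralDomain R) (ψ : AdditiveCharacter 𝔽 R) where
  open Data.Integer using (+_)

  open PolyRing 𝔽
  open PolyDegree 𝔽
  open PolyDivision 𝔽
  open PolyFactor 𝔽
  open PolyEnumeration 𝔽
  open FiniteSums R
  open CharacterSums 𝔽 R idom ψ
  open IntegerSolver commutativeRingₚ using (solve; _:*_; _:=_; con)

  open Polynomials 𝔽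
  open Sums 𝔽 R ψ
  open CommutativeRing R
  open RingProperties ring using (-0#≈0#; -‿distribˡ-*)
  open SetoidReasoning setoid

  g : Poly → Poly → Carrier
  g G P = ind₀ (P ∣? G) (q^ (deg P))

  ∏-g-all : ∀ G Es → All (_∣ G) Es → ∏ Es (g G) ≈ q^ (sum (map deg Es))
  ∏-g-all G []       []          = sym (+-identityʳ 1#)
  ∏-g-all G (P ∷ Es) (P∣G ∷ Es∣G) = begin
    g G P * ∏ Es (g G)                       ≈⟨ *-cong (ind₀-yes (P ∣? G) _ P∣G) (∏-g-all G Es Es∣G) ⟩
    q^ (deg P) * q^ (sum (map deg Es))       ≈⟨ sym (q^-+ (deg P) (sum (map deg Es))) ⟩
    q^ (deg P +ℕ sum (map deg Es))           ∎

  χ : List Poly → Poly → Carrier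
  χ []       A = 1#
  χ (P ∷ Qs) A = (1# - ind₀ (P ∣? A) 1#) * χ Qs A

  χ≈1# : ∀ {A} Qs → All (λ P → ¬ P ∣ A) Qs → χ Qs A ≈ 1#
  χ≈1# []       []           = refl
  χ≈1# {A} (P ∷ Qs) (P∤A ∷ Qs∤A) =
    trans (*-cong (trans (+-congˡ (-‿cong (ind₀-no (P ∣? A) 1# P∤A))) (x-0#≈x 1#)) (χ≈1# Qs Qs∤A)) (*-identityˡ 1#)

  χ≈0# : ∀ {A} Qs → Any (_∣ A) Qs → χ Qs A ≈ 0#
  χ≈0# {A} (P ∷ Qs) (here P∣A) = trans (*-congʳ (trans (+-congˡ (-‿cong (ind₀-yes (P ∣? A) 1# P∣A))) (-‿inverseʳ 1#))) (zeroˡ _)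
  χ≈0# (P ∷ Qs) (there any)   = trans (*-congˡ (χ≈0# Qs any)) (zeroʳ _)

  χ-cong : ∀ {A B} Qs → All (λ P → (P ∣ A → P ∣ B) × (P ∣ B → P ∣ A)) Qs → χ Qs A ≈ χ Qs B
  χ-cong []       []                = refl
  χ-cong {A} {B} (P ∷ Qs) ((⇒ , ⇐) ∷ Qs⇔) = *-cong (+-congˡ (-‿cong (ind₀-⇔ (P ∣? A) (P ∣? B) ⇒ ⇐ refl))) (χ-cong Qs Qs⇔)

  module _ (G : Poly) {H : Poly} (n : ℕ) (eH : len H ≡ suc n) (H-noSquareFactor : NoSquareFactor H) where

    S : List Poly → Poly → Carrier
    S Qs D = ∑ (polys< n) (λ A → ind₀ (D ∣? A) (χ Qs A * E G H A))

    -- The sieve state: the primes in Ds must divide A, those in Qs are still to be sieved out,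
    -- and those in Es are inert; their product is H up to the unit U.
    record Splitting (Ds Qs Es : List Poly) : Set where
      field
        U              : Poly
        U-unit         : Unit U
        Ds-irreducible : All Irreducible Ds
        Qs-irreducible : All Irreducible Qs
        Es-irreducible : All Irreducible Es
        H≋             : H ≋ U *ₚ ((prod Ds *ₚ prod Qs) *ₚ prod Es)

    private
      ind₀-split : ∀ {P D A} v (d : Dec (D ∣ A)) (p : Dec (P ∣ A)) (pd : Dec (P *ₚ D ∣ A)) → Irreducible P → ¬ P ∣ D →
                   ind₀ d ((1# - ind₀ p 1#) * v) ≈ ind₀ d v - ind₀ pd v
      ind₀-split v (yes _)   (yes _)   (yes _)    _  _   = trans (*-congʳ (-‿inverseʳ 1#)) (trans (zeroˡ v) (sym (-‿inverseʳ v)))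
      ind₀-split v (yes D∣A) (yes P∣A) (no PD∤A)  iP P∤D = ⊥-elim (PD∤A (Irreducible-*ₚ-∣ iP P∤D D∣A P∣A))
      ind₀-split {P} {D} v (yes _) (no P∤A) (yes PD∣A) _ _ = ⊥-elim (P∤A (∣-trans (A∣A*B P D) PD∣A))
      ind₀-split v (yes _)   (no _)    (no _)     _  _   = trans (*-congʳ (x-0#≈x 1#)) (trans (*-identityˡ v) (sym (x-0#≈x v)))
      ind₀-split {P} {D} v (no D∤A) _ (yes PD∣A) _ _ = ⊥-elim (D∤A (∣-trans (A∣B*A D P) PD∣A))
      ind₀-split v (no _)    _         (no _)     _  _   = sym (x-0#≈x 0#)

    S-step : ∀ {P D} Qs → Irreducible P → ¬ P ∣ D → S (P ∷ Qs) D ≈ S Qs D - S Qs (P *ₚ D)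
    S-step {P} {D} Qs iP P∤D = trans (∑-cong (polys< n) summand) (∑-- (polys< n) _ _)
      where
      summand : ∀ A → ind₀ (D ∣? A) (((1# - ind₀ (P ∣? A) 1#) * χ Qs A) * E G H A) ≈
                      ind₀ (D ∣? A) (χ Qs A * E G H A) - ind₀ (P *ₚ D ∣? A) (χ Qs A * E G H A)
      summand A = trans (ind₀-cong (D ∣? A) (*-assoc _ _ _)) (ind₀-split _ (D ∣? A) (P ∣? A) (P *ₚ D ∣? A) iP P∤D)

    module _ {Ds Es : List Poly} (split : Splitting Ds [] Es) where
      open Splitting split

      private
        D = prod Ds
        F = prod Es
        e = sum (map deg Ds)
        D≉0 : ¬ (D ≋ [])
        D≉0 = len≡suc⇒≉[] D eD
          where eD = len-prod-Irreducible Ds-irreducible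
        H≋UDF : H ≋ U *ₚ (D *ₚ F)
        H≋UDF = ≋-trans H≋ (solve 3 (λ u d e → u :* ((d :* con (+ 1)) :* e) := u :* (d :* e)) ≋-refl U D F)
        n∸e≡deg-F : n ∸ e ≡ sum (map deg Es)
        n∸e≡deg-F = ≡.trans (≡.cong (_∸ e) n≡e+deg-F) (ℕP.m+n∸m≡n e _)
          where
          n≡e+deg-F : n ≡ e +ℕ sum (map deg Es)
          n≡e+deg-F = ℕP.suc-injective (≡.trans (≡.sym eH) (≡.trans (len-cong H≋UDF)
                        (len-*ₚ U (D *ₚ F) 0 _ (Unit⇒len≡1 U U-unit)
                          (len-*ₚ D F e _ (len-prod-Irreducible Ds-irreducible)
                                          (len-prod-Irreducible Es-irreducible)))))
        D∣H : D ∣ H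
        D∣H = U *ₚ F , ≋-trans H≋UDF (solve 3 (λ u d e → u :* (d :* e) := (u :* e) :* d) ≋-refl U D F)
        F∣H : F ∣ H
        F∣H = U *ₚ D , ≋-trans H≋UDF (solve 3 (λ u d e → u :* (d :* e) := (u :* d) :* e) ≋-refl U D F)
        H∣GD⇒F∣G : H ∣ G *ₚ D → F ∣ G
        H∣GD⇒F∣G (Y , GD≋YH) = Y *ₚ U , *ₚ-cancelˡ D D≉0 (≋-trans (*ₚ-comm D G) (≋-trans GD≋YH (≋-trans (*ₚ-congʳ Y H≋UDF)
                                 (solve 4 (λ y u d e → y :* (u :* (d :* e)) := d :* ((y :* u) :* e)) ≋-refl Y U D F))))
        F∣G⇒H∣GD : F ∣ G → H ∣ G *ₚ D
        F∣G⇒H∣GD (X , G≋XE) = X *ₚ V , ≋-trans (*ₚ-congˡ D G≋XE) (≋-trans (solve 3 (λ x e d → (x :* e) :* d := x :* (d :* e)) ≋-refl X F D)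
                                  (≋-trans (*ₚ-congʳ X DF≋VH) (≋-sym (*ₚ-assoc X V H))))
          where
          H∣DF = ≋Unit*⇒∣ U U-unit H≋UDF
          V = proj₁ H∣DF
          DF≋VH = proj₂ H∣DF
        ∈Es⇒∣F : All (_∣ F) Es
        ∈Es⇒∣F = All.tabulate (λ P∈Es → ∈⇒∣prod Es (Any.map (λ { ≡.refl → ≋-refl }) P∈Es))

      S-base : S [] D ≈ ∏ Es (g G)
      S-base = begin
        S [] D                                          ≈⟨ ∑-cong (polys< n) (λ A → ind₀-cong (D ∣? A) (*-identityˡ _)) ⟩
        ∑ (polys< n) (λ A → ind₀ (D ∣? A) (E G H A))   ≈⟨ ∑-E-multiples G n eH e (len-prod-Irreducible Ds-irreducible) D∣H ⟩
        ind₀ (H ∣? G *ₚ D) (q^ (n ∸ e))                 ≈⟨ by-cases (H ∣? G *ₚ D) ⟩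
        ∏ Es (g G)                                      ∎
        where
        by-cases : (d : Dec (H ∣ G *ₚ D)) → ind₀ d (q^ (n ∸ e)) ≈ ∏ Es (g G)
        by-cases (yes H∣GD) = sym (trans (∏-g-all G Es (All.map (λ P∣F → ∣-trans P∣F (H∣GD⇒F∣G H∣GD)) ∈Es⇒∣F))
                                         (reflexive (≡.cong q^ (≡.sym n∸e≡deg-F))))
        by-cases (no H∤GD) with All.all? (_∣? G) Es
        ... | yes Es∣G = ⊥-elim (H∤GD (F∣G⇒H∣GD (prod-∣ Es G Es-irreducible Es-pairwise Es∣G)))
          where Es-pairwise = NoSquareFactor-prod-pairwise Es H H-noSquareFactor Es-irreducible F∣H
        ... | no ¬Es∣G = sym (∏-≈0# Es (Any.map (λ {P} P∤G → ind₀-no (P ∣? G) _ P∤G) (All.¬All⇒Any¬ (_∣? G) Es ¬Es∣G)))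

    private
      move-to-Es : ∀ {P Ds Qs Es} → Splitting Ds (P ∷ Qs) Es → Splitting Ds Qs (P ∷ Es)
      move-to-Es {P} {Ds} {Qs} {Es} split = record
        { U = U ; U-unit = U-unit ; Ds-irreducible = Ds-irreducible ; Qs-irreducible = All.tail Qs-irreducible
        ; Es-irreducible = All.head Qs-irreducible ∷ Es-irreducible
        ; H≋ = ≋-trans H≋ (solve 5 (λ u d p q e → u :* ((d :* (p :* q)) :* e) := u :* ((d :* q) :* (p :* e))) ≋-refl U (prod Ds) P (prod Qs) (prod Es)) }
        where open Splitting split

      move-to-Ds : ∀ {P Ds Qs Es} → Splitting Ds (P ∷ Qs) Es → Splitting (P ∷ Ds) Qs Es
      move-to-Ds {P} {Ds} {Qs} {Es} split = record
        { U = U ; U-unit = U-unit ; Ds-irreducible = All.head Qs-irreducible ∷ Ds-irreducible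
        ; Qs-irreducible = All.tail Qs-irreducible ; Es-irreducible = Es-irreducible
        ; H≋ = ≋-trans H≋ (solve 5 (λ u d p q e → u :* ((d :* (p :* q)) :* e) := u :* (((p :* d) :* q) :* e)) ≋-refl U (prod Ds) P (prod Qs) (prod Es)) }
        where open Splitting split

      P∤prod-Ds : ∀ {P Ds Qs Es} → Splitting Ds (P ∷ Qs) Es → ¬ P ∣ prod Ds
      P∤prod-Ds {P} {Ds} {Qs} {Es} split = NoSquareFactor-∤ P (prod Ds) H H-noSquareFactor (All.head Qs-irreducible)
        (U *ₚ (prod Qs *ₚ prod Es) , ≋-trans H≋ (solve 5 (λ u d p q e → u :* ((d :* (p :* q)) :* e) := (u :* (q :* e)) :* (p :* d))
                                                       ≋-refl U (prod Ds) P (prod Qs) (prod Es)))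
        where open Splitting split

    inclusion-exclusion : ∀ Qs {Ds Es} → Splitting Ds Qs Es →
                          S Qs (prod Ds) ≈ sgn (length Qs) * (∏ Es (g G) * ∏ Qs (λ P → 1# - g G P))
    inclusion-exclusion [] {Ds} {Es} split = begin
      S [] (prod Ds)               ≈⟨ S-base split ⟩
      ∏ Es (g G)                   ≈⟨ sym (*-identityʳ _) ⟩
      ∏ Es (g G) * 1#              ≈⟨ sym (*-identityˡ _) ⟩
      1# * (∏ Es (g G) * 1#)       ∎
    inclusion-exclusion (P ∷ Qs) {Ds} {Es} split = begin
      S (P ∷ Qs) (prod Ds)                           ≈⟨ S-step Qs (All.head (Splitting.Qs-irreducible split)) (P∤prod-Ds split) ⟩
      S Qs (prod Ds) - S Qs (P *ₚ prod Ds)           ≈⟨ +-cong (inclusion-exclusion Qs (move-to-Es split))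
                                                              (-‿cong (inclusion-exclusion Qs (move-to-Ds split))) ⟩
      s * ((g G P * Eg) * X) - s * (Eg * X)          ≈⟨ rearrange ⟩
      - s * (Eg * (X - g G P * X))                   ≈⟨ *-congˡ (*-congˡ (sym 1-p*x≈x-px)) ⟩
      - s * (Eg * ((1# - g G P) * X))                ∎
      where
      s  = sgn (length Qs)
      Eg = ∏ Es (g G)
      X  = ∏ Qs (λ P → 1# - g G P)
      rearrange : s * ((g G P * Eg) * X) - s * (Eg * X) ≈ - s * (Eg * (X - g G P * X))
      rearrange = solveᴿ 4 (λ s p e x → s ⊗ ((p ⊗ e) ⊗ x) ⊖ s ⊗ (e ⊗ x) ⊜ (⊝ s) ⊗ (e ⊗ (x ⊖ p ⊗ x))) refl s (g G P) Eg X
        where open IntegerSolver R using () renaming (solve to solveᴿ; _:*_ to _⊗_; _:-_ to _⊖_; :-_ to ⊝_; _:=_ to _⊜_)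
      1-p*x≈x-px : (1# - g G P) * X ≈ X - g G P * X
      1-p*x≈x-px = trans (distribʳ X 1# (- g G P)) (+-cong (*-identityˡ X) (sym (-‿distribˡ-* (g G P) X)))

module MobiusEta (𝔽 : FiniteField) (R : CommutativeRing 0ℓ 0ℓ) (idom : IsIntegralDomain R) (ψ : AdditiveCharacter 𝔽 R) where
  open Data.Integer using (+_)
  open PolyRing 𝔽
  open PolyDegree 𝔽
  open PolyDivision 𝔽
  open PolyFactor 𝔽
  open PolyEnumeration 𝔽
  open SquareFreeStructure 𝔽
  open FiniteSums R
  open CharacterSums 𝔽 R idom ψ
  open InclusionExclusion 𝔽 R idom ψ
  open IntegerSolver commutativeRingₚ using (solve; _:+_; _:*_; _:-_; :-_; _:=_; con)

  open Polynomials 𝔽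
  open AdditiveCharacter ψ
  open Sums 𝔽 R ψ
  open CommutativeRing R
  open SetoidReasoning setoid

  module _ (G H : Poly) (sf : SquareFree H) (F : PrimeFactorisation H) {LH : List Poly} (rrs : ReducedResidueSystem H LH) where
    open PrimeFactorisation F
    open SquareFreeFactorisation sf F

    private
      n : ℕ
      n = proj₁ (≉[]⇒len≡suc H H≉[])
      eH : len H ≡ suc n
      eH = proj₂ (≉[]⇒len≡suc H H≉[])
      LH-coprime = proj₁ rrs
      LH-incongruent = proj₁ (proj₂ rrs)
      LH-complete = proj₂ (proj₂ rrs)

      h : Poly → Carrier
      h A = ind₀ (1ₚ ∣? A) (χ factors A * E G H A)

      E-cong-mod : ∀ {A D} → H ∣ A -ₚ D → E G H A ≈ E G H D
      E-cong-mod {A} {D} H∣A-D = reflexive (≡.cong λ-fun (t-cong-mod H (G *ₚ A) (G *ₚ D) H≉[]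
        (∣-congʳ (solve 3 (λ g a d → g :* (a :- d) := g :* a :- g :* d) ≋-refl G A D) (∣B⇒∣A*B G H∣A-D))))

      h-cong-mod : ∀ {A D} → H ∣ A -ₚ D → h D ≈ h A
      h-cong-mod {A} {D} H∣A-D = ind₀-⇔ (1ₚ ∣? D) (1ₚ ∣? A) (λ _ → 1ₚ∣ A) (λ _ → 1ₚ∣ D)
        (*-cong (χ-cong factors (All.map (λ P∣H → swap (∣-resp-mod P∣H H∣A-D)) factors-∣)) (sym (E-cong-mod H∣A-D)))

      h≈E : ∀ {D} → Coprime D H → h D ≈ E G H D
      h≈E {D} D⊥H = trans (ind₀-yes (1ₚ ∣? D) _ (1ₚ∣ D)) (trans (*-congʳ (χ≈1# factors (Coprime⇒∤factors D⊥H))) (*-identityˡ _))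

      residue-class-in-polys< : ∀ {D} → AtMostOne (λ A → H ∣ A -ₚ D) (polys< n) × (Any (λ A → H ∣ A -ₚ D) (polys< n) ⊎ h D ≈ 0#)
      residue-class-in-polys< {D} = polys<-atMostOne n same-class , inj₁ (polys<-any n len-rem≤n rem-class)
        where
        same-class : ∀ {A A′} → len A ≤ℕ n → len A′ ≤ℕ n → H ∣ A -ₚ D → H ∣ A′ -ₚ D → A ≋ A′
        same-class {A} {A′} lA lA′ H∣A-D H∣A′-D = -ₚ≋[]⇒≋ (∣-len<⇒≋[] H (A -ₚ A′) H≉[] H∣A-A′ len<)
          where
          H∣A-A′ : H ∣ A -ₚ A′
          H∣A-A′ = ∣-congʳ (solve 3 (λ a a′ d → (a :- d) :- (a′ :- d) := a :- a′) ≋-refl A A′ D) (∣--ₚ H∣A-D H∣A′-D)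
          len< : len (A -ₚ A′) <ℕ len H
          len< = ≡.subst (len (A -ₚ A′) <ℕ_) (≡.sym eH) (ℕ.s≤s (len-+ₚ≤ A (negₚ A′) n lA (≡.subst (_≤ℕ n) (≡.sym (len-negₚ A′)) lA′)))
        division = rem-spec D H H≉[]
        len-rem≤n : len (rem D H) ≤ℕ n
        len-rem≤n = ℕP.≤-pred (≡.subst (len (rem D H) <ℕ_) eH (proj₂ division))
        rem-class : ∀ {B} → B ≋ rem D H → H ∣ B -ₚ D
        rem-class {B} B≋rem = negₚ (proj₁ (proj₁ division)) ,
          ≋-trans (+ₚ-cong B≋rem (negₚ-cong (proj₂ (proj₁ division))))
                  (solve 3 (λ q h r → r :- (q :* h :+ r) := (:- q) :* h) ≋-refl (proj₁ (proj₁ division)) H (rem D H))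

      residue-class-in-LH : ∀ {A} → AtMostOne (λ D → H ∣ A -ₚ D) LH × (Any (λ D → H ∣ A -ₚ D) LH ⊎ h A ≈ 0#)
      residue-class-in-LH {A} = AllPairs.map incongruent LH-incongruent , classify (Any.any? (_∣? A) factors)
        where
        incongruent : ∀ {D D′} → ¬ Congruent H D D′ → H ∣ A -ₚ D → H ∣ A -ₚ D′ → ⊥
        incongruent {D} {D′} D≢D′ H∣A-D H∣A-D′ =
          D≢D′ (∣⇒∣ₚ (∣-congʳ (solve 3 (λ a d d′ → (a :- d′) :- (a :- d) := d :- d′) ≋-refl A D D′) (∣--ₚ H∣A-D′ H∣A-D)))
        classify : Dec (Any (_∣ A) factors) → Any (λ D → H ∣ A -ₚ D) LH ⊎ h A ≈ 0#
        classify (yes P∣A) = inj₂ (ind₀-≈0# (1ₚ ∣? A) (λ _ → trans (*-congʳ (χ≈0# factors P∣A)) (zeroˡ _)))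
        classify (no ¬P∣A) = inj₁ (Any.map ∣ₚ⇒∣ (LH-complete A (∤factors⇒Coprime A (All.¬Any⇒All¬ factors ¬P∣A))))

    η≈S : η G H LH ≈ S G n eH H-noSquareFactor factors 1ₚ
    η≈S = begin
      ∑ LH (E G H)        ≈⟨ ∑-cong-All LH LH-coprime (λ D D⊥H → sym (h≈E D⊥H)) ⟩
      ∑ LH h              ≈⟨ ∑-matching (λ D A → H ∣? A -ₚ D) LH (polys< n) h h h-cong-mod
                               (All.tabulate (λ _ → residue-class-in-polys<)) (All.tabulate (λ _ → residue-class-in-LH)) ⟩
      ∑ (polys< n) h      ∎

    μη≈∏ : ∀ {μ} → μ ≡ (ℤ.- (+ 1)) ℤ.^ length factors → intR R μ * η G H LH ≈ ∏ factors (λ P → 1# - g G P)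
    μη≈∏ {μ} μ≡ = begin
      intR R μ * η G H LH          ≈⟨ *-cong (trans (reflexive (≡.cong (intR R) μ≡)) (intR-[-1]^ r)) (trans η≈S sieve) ⟩
      sgn r * (sgn r * (1# * X))   ≈⟨ sym (*-assoc _ _ _) ⟩
      (sgn r * sgn r) * (1# * X)   ≈⟨ *-cong (sgn*sgn≈1 r) (*-identityˡ X) ⟩
      1# * X                       ≈⟨ *-identityˡ X ⟩
      X                            ∎
      where
      r = length factors
      X = ∏ factors (λ P → 1# - g G P)
      splitting : Splitting G n eH H-noSquareFactor [] factors []
      splitting = record
        { U = cofactor ; U-unit = cofactor-unit ; Ds-irreducible = [] ; Qs-irreducible = factors-irreducible ; Es-irreducible = []
        ; H≋ = ≋-trans H≋cofactor*prod (solve 2 (λ u p → u :* p := u :* ((con (+ 1) :* p) :* con (+ 1))) ≋-refl cofactor (prod factors)) }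
      sieve : S G n eH H-noSquareFactor factors 1ₚ ≈ sgn r * (1# * X)
      sieve = inclusion-exclusion G n eH H-noSquareFactor factors splitting

  private
    c : Poly → Poly → Carrier
    c P Q = ind₁ (P ≋? Q) (1# - q^ (deg P))

    c-sym : ∀ P Q → c P Q ≈ c Q P
    c-sym P Q with P ≋? Q | Q ≋? P
    ... | yes P≋Q | yes _   = reflexive (≡.cong (λ k → 1# - q^ (k ℕ.∸ 1)) (len-cong P≋Q))
    ... | yes P≋Q | no Q≉P  = ⊥-elim (Q≉P (≋-sym P≋Q))
    ... | no P≉Q  | yes Q≋P = ⊥-elim (P≉Q (≋-sym Q≋P))
    ... | no _    | no _    = refl

    ∏-c : ∀ {Y} (FY : PrimeFactorisation Y) P → Monic P → Irreducible P → ∏ (PrimeFactorisation.factors FY) (c P) ≈ 1# - g Y P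
    ∏-c {Y} FY P mP iP with P ∣? Y
    ... | yes P∣Y = ∏-ind₁-unique (P ≋?_) factors (λ _ → 1# - q^ (deg P)) _ (λ _ _ → refl)
                      (AllPairs.map (λ Q≉Q′ P≋Q P≋Q′ → Q≉Q′ (coeff-≡ (≋-trans (≋-sym P≋Q) P≋Q′))) factors-distinct)
                      (Any.map (λ {Q} P≈Q → ⟨_⟩ {P} {Q} P≈Q) (factors-complete P mP iP (∣⇒∣ₚ P∣Y)))
      where open PrimeFactorisation FY
    ... | no P∤Y = trans (∏-ind₁-none (P ≋?_) factors (λ _ → 1# - q^ (deg P))
                           (All.map (λ { {Q} (_ , _ , Q∣Y) P≋Q → P∤Y (∣-congˡ (≋-sym P≋Q) (∣ₚ⇒∣ Q∣Y)) }) factors-valid))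
                         (sym (x-0#≈x 1#))
      where open PrimeFactorisation FY

  -- Both sides equal the product of 1 - q^(deg P) over the common prime factors P of G and H.
  ∏-1-g-sym : ∀ {G H} (FG : PrimeFactorisation G) (FH : PrimeFactorisation H) →
              ∏ (PrimeFactorisation.factors FH) (λ P → 1# - g G P) ≈ ∏ (PrimeFactorisation.factors FG) (λ Q → 1# - g H Q)
  ∏-1-g-sym {G} {H} FG FH = begin
    ∏ PsH (λ P → 1# - g G P)              ≈⟨ ∏-cong-All PsH (PrimeFactorisation.factors-valid FH) (λ P (mP , iP , _) → sym (∏-c FG P mP iP)) ⟩
    ∏ PsH (λ P → ∏ PsG (c P))             ≈⟨ ∏-swap PsH PsG c ⟩
    ∏ PsG (λ Q → ∏ PsH (λ P → c P Q))     ≈⟨ ∏-cong PsG (λ Q → ∏-cong PsH (λ P → c-sym P Q)) ⟩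
    ∏ PsG (λ Q → ∏ PsH (c Q))             ≈⟨ ∏-cong-All PsG (PrimeFactorisation.factors-valid FG) (λ Q (mQ , iQ , _) → ∏-c FH Q mQ iQ) ⟩
    ∏ PsG (λ Q → 1# - g H Q)              ∎
    where
    PsG = PrimeFactorisation.factors FG
    PsH = PrimeFactorisation.factors FH

corollary3p1 : (𝔽 : FiniteField) (R : CommutativeRing 0ℓ 0ℓ) → IsIntegralDomain R →
  (ψ : AdditiveCharacter 𝔽 R) →
  let open Polynomials 𝔽
      open Sums 𝔽 R ψ
      open CommutativeRing R
  in (G H : Poly) → SquareFree G → SquareFree H →
     (μG μH : ℤ) → MobiusValue G μG → MobiusValue H μH →
     (LG LH : List Poly) → ReducedResidueSystem G LG → ReducedResidueSystem H LH →
     intR R μH * η G H LH ≈ intR R μG * η H G LG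
corollary3p1 𝔽 R idom ψ G H sfG sfH μG μH mG mH LG LH rG rH = begin
  intR R μH * η G H LH                                    ≈⟨ μη≈∏ G H sfH FH rH μH≡ ⟩
  ∏ (PrimeFactorisation.factors FH) (λ P → 1# - g G P)   ≈⟨ ∏-1-g-sym FG FH ⟩
  ∏ (PrimeFactorisation.factors FG) (λ Q → 1# - g H Q)   ≈⟨ sym (μη≈∏ H G sfG FG rG μG≡) ⟩
  intR R μG * η H G LG                                    ∎
  where
  open MobiusEta 𝔽 R idom ψ
  open Sums 𝔽 R ψ
  open SquareFreeStructure 𝔽 using (PrimeFactorisation; MobiusValue⇒PrimeFactorisation)
  open InclusionExclusion 𝔽 R idom ψ using (g)
  open FiniteSums R using (∏)
  open CommutativeRing R
  open SetoidReasoning setoid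
  FG = proj₁ (MobiusValue⇒PrimeFactorisation G sfG mG)
  μG≡ = proj₂ (MobiusValue⇒PrimeFactorisation G sfG mG)
  FH = proj₁ (MobiusValue⇒PrimeFactorisation H sfH mH)
  μH≡ = proj₂ (MobiusValue⇒PrimeFactorisation H sfH mH)
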